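{- Let $G$ be a connected graph every block of which is isomorphic to $C_5$ (the cycle of length 5). Then $G$ is not odd 4-colorable. On the other hand, for each vertex $v$ of $G$ there is a proper 4-coloring $\varphi$ of $G$ such that every vertex $u\neq v$ satisfies the odd condition with respect to $\varphi$ and $v$ satisfies the even condition with respect to $\varphi$.
   Context: All graphs are simple, finite and undirected. A (proper) $k$-coloring of $G$ is a map $\varphi: V(G)\to\{1,\dots,k\}$ with $\varphi(u)\neq\varphi(w)$ for every edge $uw$. A vertex $x$ satisfies the odd condition with respect to $\varphi$ if $|\varphi^{ -1}(i)\cap N_G(x)|$ is odd for some color $i\in\{1,\dots,k\}$, and satisfies the even condition if $|\varphi^{ -1}(i)\cap N_G(x)|$ is even (possibly zero) for some color $i\in\{1,\dots,k\}\setminus\{\varphi(x)\}$. An odd $k$-coloring is a $k$-coloring in which every non-isolated vertex satisfies the odd condition; $G$ is odd $k$-colorable if it has one. A block is a maximal connected subgraph without a cut vertex. -}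

module Defs where

open import Data.Nat using (ℕ; suc; _%_; _≡ᵇ_)
open import Data.Nat.Divisibility using (_∣_)
open import Data.Bool using (Bool; true; false; _∧_; _∨_; not)
open import Data.Fin using (Fin; toℕ)
open import Data.Fin.Properties using (_≟_)
open import Data.List using (length; filterᵇ; allFin)
open import Data.Product using (Σ; ∃; _×_; _,_)
open import Relation.Nullary using (¬_; ⌊_⌋)
open import Relation.Binary.PropositionalEquality using (_≡_; _≢_; refl)
open import Function.Definitions using (Injective)

record Graph (n : ℕ) : Set where
  field
    adj    : Fin n → Fin n → Bool
    sym    : ∀ u w → adj u w ≡ adj w u
    irrefl : ∀ u → adj u u ≡ false
open Graph public

record Subgraph {n : ℕ} (G : Graph n) : Set where
  field
    V     : Fin n → Bool
    E     : Fin n → Fin n → Bool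
    E-sym : ∀ u w → E u w ≡ E w u
    E⊆adj : ∀ u w → E u w ≡ true → adj G u w ≡ true
    E⊆V   : ∀ u w → E u w ≡ true → V u ≡ true
open Subgraph public

whole : ∀ {n} (G : Graph n) → Subgraph G
whole G = record
  { V = λ _ → true ; E = adj G ; E-sym = sym G
  ; E⊆adj = λ _ _ e → e ; E⊆V = λ _ _ _ → refl }

_⊑_ : ∀ {n} {G : Graph n} → Subgraph G → Subgraph G → Set
H ⊑ H' = (∀ v → V H v ≡ true → V H' v ≡ true)
       × (∀ u w → E H u w ≡ true → E H' u w ≡ true)

-- Walks in H from u to w all of whose vertices lie in V(H) and satisfy
-- the predicate ok (used to delete a vertex).
data Walk {n : ℕ} {G : Graph n} (H : Subgraph G) (ok : Fin n → Bool)
     : Fin n → Fin n → Set where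
  here  : ∀ {u} → V H u ≡ true → ok u ≡ true → Walk H ok u u
  step  : ∀ {u v w} → ok u ≡ true → E H u v ≡ true → Walk H ok v w
        → Walk H ok u w

Connected : ∀ {n} {G : Graph n} → Subgraph G → Set
Connected {n} H =
  (∃ λ v → V H v ≡ true)
  × (∀ u w → V H u ≡ true → V H w ≡ true → Walk H (λ _ → true) u w)

-- c is not a cut vertex of H (H connected): H − c is connected
-- (possibly empty), i.e. any two vertices of H other than c are joined by
-- a walk in H avoiding c.
NoCutVertex : ∀ {n} {G : Graph n} → Subgraph G → Set
NoCutVertex {n} H =
  ∀ c → V H c ≡ true →
  ∀ u w → V H u ≡ true → V H w ≡ true → u ≢ c → w ≢ c →
  Walk H (λ x → not ⌊ x ≟ c ⌋) u w

IsBlock : ∀ {n} {G : Graph n} → Subgraph G → Set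
IsBlock {G = G} H =
  Connected H × NoCutVertex H
  × (∀ (H' : Subgraph G) → H ⊑ H' → Connected H' → NoCutVertex H' → H' ⊑ H)

C5adj : Fin 5 → Fin 5 → Bool
C5adj i j = (toℕ j ≡ᵇ (suc (toℕ i) % 5)) ∨ (toℕ i ≡ᵇ (suc (toℕ j) % 5))

IsoC5 : ∀ {n} {G : Graph n} → Subgraph G → Set
IsoC5 {n} H =
  Σ (Fin 5 → Fin n) λ f →
    Injective _≡_ _≡_ f
    × (∀ i → V H (f i) ≡ true)
    × (∀ v → V H v ≡ true → ∃ λ i → f i ≡ v)
    × (∀ i j → E H (f i) (f j) ≡ C5adj i j)

Coloring : ℕ → ℕ → Set
Coloring n k = Fin n → Fin k

Proper : ∀ {n k} → Graph n → Coloring n k → Set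
Proper G φ = ∀ u w → adj G u w ≡ true → φ u ≢ φ w

nbrCount : ∀ {n k} → Graph n → Coloring n k → Fin n → Fin k → ℕ
nbrCount {n} G φ x i =
  length (filterᵇ (λ y → adj G x y ∧ ⌊ φ y ≟ i ⌋) (allFin n))

Even Odd : ℕ → Set
Even m = 2 ∣ m
Odd m = ¬ (2 ∣ m)

OddCond : ∀ {n k} → Graph n → Coloring n k → Fin n → Set
OddCond G φ x = ∃ λ i → Odd (nbrCount G φ x i)

EvenCond : ∀ {n k} → Graph n → Coloring n k → Fin n → Set
EvenCond G φ x = ∃ λ i → i ≢ φ x × Even (nbrCount G φ x i)

NonIsolated : ∀ {n} → Graph n → Fin n → Set
NonIsolated G x = ∃ λ y → adj G x y ≡ true

IsOddColoring : ∀ {n k} → Graph n → Coloring n k → Set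
IsOddColoring G φ = Proper G φ × (∀ x → NonIsolated G x → OddCond G φ x)

OddColorable : ∀ {n} → ℕ → Graph n → Set
OddColorable {n} k G = ∃ λ (φ : Coloring n k) → IsOddColoring G φ

-- Root the graph at a vertex r and let level x be the distance from r. In each block (a 5-cycle)
-- descending paths to r show that there is a unique lowest vertex, the top, and that the levels
-- around the cycle are t, t+1, t+2, t+2, t+1: anything else yields a path outside the block between
-- two of its vertices, contradicting maximality. Hence every x ≠ r has a unique neighbour one level
-- down (its parent) and at most one on its own level (its sibling).
--
-- Colouring r with 0 and every other vertex with its parent's colour plus 1, or plus 2 for the
-- larger of two siblings, is proper; each u ≠ r sees its parent's colour exactly once, and no
-- neighbour of r has colour 2.
--
-- Conversely, for an odd 4-colouring ψ, descending induction on levels shows that the two level-one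
-- vertices of every block get the same colour: the remaining neighbours of the block's vertices
-- pair off with equal colours, so the odd condition forces four inequalities across the 5-cycle,
-- which leave only this possibility. Then the neighbours of r pair off in the same way, and r
-- violates the odd condition.

module Submission where

open import Data.Bool using (Bool; true; false; _∧_; _∨_; not; if_then_else_)
open import Data.Bool.Properties using (∧-comm; ∨-comm; ∧-identityʳ) renaming (_≟_ to _≟ᵇ_)
open import Data.Empty using (⊥; ⊥-elim)
open import Data.Fin using (Fin; zero; suc; toℕ; #_)
open import Data.Fin.Properties using (_≟_; all?; any?; toℕ-injective)
open import Data.List using (length; filterᵇ; allFin; tabulate)
open import Data.Nat using (ℕ; zero; suc; _+_; _*_; _∸_; _⊓_; _≤_; _<_; _≤?_; _<?_; z≤n; s≤s; s≤s⁻¹)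
open import Data.Nat.Divisibility using (_∣0; ∣-refl; ∣1⇒≡1; ∣m∣n⇒∣m+n)
open import Data.Nat.DivMod using (_mod_)
open import Data.Nat.Properties
  using ( ≤-refl; ≤-reflexive; ≤-trans; ≤-antisym; <-trans; <-irrefl; <-asym; <-cmp; <⇒≤; <⇒≢; <⇒≱; ≰⇒>
        ; ≤∧≢⇒<; n≤1+n; n<1+n; m<n⇒m<1+n; n≤0⇒n≡0; 1+n≢0; suc-injective; m≤m+n; m≤n+m; m+n≡0⇒n≡0
        ; +-comm; +-suc; +-identityʳ; *-identityʳ; +-cancelˡ-≡; +-mono-≤; +-mono-<-≤; +-mono-≤-<; +-monoˡ-≤
        ; +-commutativeSemigroup )
  renaming (_≟_ to _≟ℕ_)
open import Algebra.Properties.CommutativeSemigroup +-commutativeSemigroup using (x∙yz≈y∙xz)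
open import Data.Product using (∃; ∃₂; _×_; _,_; proj₁; proj₂)
open import Data.Sum using (_⊎_; inj₁; inj₂; [_,_]′)
open import Data.Unit using (⊤; tt)
open import Data.Vec using ([]; _∷_; lookup)
open import Function using (_∘_; id)
open import Relation.Binary.Construct.Closure.ReflexiveTransitive using (Star; ε; _◅_; _◅◅_; reverse)
import Relation.Binary.Construct.Closure.ReflexiveTransitive as Star
open import Relation.Binary.Definitions using (tri<; tri≈; tri>)
open import Relation.Binary.PropositionalEquality
  using (_≡_; _≢_; refl; sym; trans; cong; cong₂; subst; subst₂; module ≡-Reasoning)
open import Relation.Nullary using (¬_; Dec; yes; no; ⌊_⌋)
open import Relation.Nullary.Decidable using (True; toWitness; decidable-stable; _→-dec_; _×-dec_; _⊎-dec_; ¬?)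
open import Relation.Nullary.Negation using (¬¬-map)

open import Defs hiding (sym)

∧-true⁻ : ∀ a {b} → a ∧ b ≡ true → a ≡ true × b ≡ true
∧-true⁻ true e = refl , e

∧-true⁺ : ∀ {a b} → a ≡ true → b ≡ true → a ∧ b ≡ true
∧-true⁺ refl refl = refl

∨-true⁻ : ∀ a {b} → a ∨ b ≡ true → a ≡ true ⊎ b ≡ true
∨-true⁻ true _ = inj₁ refl
∨-true⁻ false e = inj₂ e

∨-trueˡ : ∀ {a} b → a ≡ true → a ∨ b ≡ true
∨-trueˡ _ refl = refl

∨-trueʳ : ∀ a {b} → b ≡ true → a ∨ b ≡ true
∨-trueʳ true _ = refl
∨-trueʳ false e = e

≢true⇒false : ∀ {a} → a ≢ true → a ≡ false
≢true⇒false {false} _ = refl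
≢true⇒false {true} ne = ⊥-elim (ne refl)

true≢false : true ≢ false
true≢false ()

≟-refl : ∀ {n} (x : Fin n) → ⌊ x ≟ x ⌋ ≡ true
≟-refl x with x ≟ x
... | yes _ = refl
... | no x≢x = ⊥-elim (x≢x refl)

≟-true⁺ : ∀ {n} {x y : Fin n} → x ≡ y → ⌊ x ≟ y ⌋ ≡ true
≟-true⁺ {x = x} refl = ≟-refl x

≟-true⁻ : ∀ {n} {x y : Fin n} → ⌊ x ≟ y ⌋ ≡ true → x ≡ y
≟-true⁻ {x = x} {y} e with x ≟ y
... | yes x≡y = x≡y

≢⇒not-≟ : ∀ {n} {x y : Fin n} → x ≢ y → not ⌊ x ≟ y ⌋ ≡ true
≢⇒not-≟ {x = x} {y} x≢y with x ≟ y
... | yes x≡y = ⊥-elim (x≢y x≡y)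
... | no _ = refl

not-≟⇒≢ : ∀ {n} {x y : Fin n} → not ⌊ x ≟ y ⌋ ≡ true → x ≢ y
not-≟⇒≢ {x = x} {y} e with x ≟ y
... | no x≢y = x≢y

∑ : ∀ {n} → (Fin n → ℕ) → ℕ
∑ {zero} f = 0
∑ {suc n} f = f zero + ∑ (f ∘ suc)

∑-cong : ∀ {n} {f g : Fin n → ℕ} → (∀ i → f i ≡ g i) → ∑ f ≡ ∑ g
∑-cong {zero} _ = refl
∑-cong {suc n} f≗g = cong₂ _+_ (f≗g zero) (∑-cong (f≗g ∘ suc))

∑-mono-≤ : ∀ {n} {f g : Fin n → ℕ} → (∀ i → f i ≤ g i) → ∑ f ≤ ∑ g
∑-mono-≤ {zero} _ = z≤n
∑-mono-≤ {suc n} f≤g = +-mono-≤ (f≤g zero) (∑-mono-≤ (f≤g ∘ suc))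

∑-mono-< : ∀ {n} {f g : Fin n → ℕ} → (∀ i → f i ≤ g i) → ∀ j → f j < g j → ∑ f < ∑ g
∑-mono-< f≤g zero fj<gj = +-mono-<-≤ fj<gj (∑-mono-≤ (f≤g ∘ suc))
∑-mono-< f≤g (suc j) fj<gj = +-mono-≤-< (f≤g zero) (∑-mono-< (f≤g ∘ suc) j fj<gj)

∑-≤-* : ∀ {n} m {f : Fin n → ℕ} → (∀ i → f i ≤ m) → ∑ f ≤ n * m
∑-≤-* {zero} m _ = z≤n
∑-≤-* {suc n} m f≤m = +-mono-≤ (f≤m zero) (∑-≤-* m (f≤m ∘ suc))

≤-∑ : ∀ {n} (f : Fin n → ℕ) i → f i ≤ ∑ f
≤-∑ f zero = m≤m+n _ _
≤-∑ f (suc i) = ≤-trans (≤-∑ (f ∘ suc) i) (m≤n+m _ _)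

count : ∀ {n} → (Fin n → Bool) → ℕ
count P = ∑ λ i → if P i then 1 else 0

count-cong : ∀ {n} {P Q : Fin n → Bool} → (∀ i → P i ≡ Q i) → count P ≡ count Q
count-cong P≗Q = ∑-cong λ i → cong (if_then 1 else 0) (P≗Q i)

indicator-mono : ∀ {p q} → (p ≡ true → q ≡ true) → (if p then 1 else 0) ≤ (if q then 1 else 0)
indicator-mono {true} p⇒q rewrite p⇒q refl = ≤-refl
indicator-mono {false} _ = z≤n

count-mono-≤ : ∀ {n} {P Q : Fin n → Bool} → (∀ i → P i ≡ true → Q i ≡ true) → count P ≤ count Q
count-mono-≤ P⊆Q = ∑-mono-≤ λ i → indicator-mono (P⊆Q i)

count≤n : ∀ {n} (P : Fin n → Bool) → count P ≤ n
count≤n {n} P = ≤-trans (∑-≤-* 1 λ i → indicator-mono {P i} {true} λ _ → refl) (≤-reflexive (*-identityʳ n))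

count-mono-< : ∀ {n} {P Q : Fin n → Bool} → (∀ i → P i ≡ true → Q i ≡ true)
             → ∀ j → P j ≡ false → Q j ≡ true → count P < count Q
count-mono-< {P = P} {Q} P⊆Q j Pj Qj = ∑-mono-< (λ i → indicator-mono (P⊆Q i)) j Pj<Qj
  where
  Pj<Qj : (if P j then 1 else 0) < (if Q j then 1 else 0)
  Pj<Qj rewrite Pj | Qj = s≤s z≤n

count-none : ∀ {n} {P : Fin n → Bool} → (∀ i → P i ≡ false) → count P ≡ 0
count-none {zero} _ = refl
count-none {suc n} {P} none rewrite none zero = count-none (none ∘ suc)

count-suc⇒∃ : ∀ {n} {P : Fin n → Bool} {k} → count P ≡ suc k → ∃ λ i → P i ≡ true
count-suc⇒∃ {P = P} eq with any? (λ i → P i ≟ᵇ true)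
... | yes found = found
... | no none with trans (sym eq) (count-none λ i → ≢true⇒false λ Pi → none (i , Pi))
...   | ()

length-filterᵇ-tabulate : ∀ {n m} (P : Fin m → Bool) (g : Fin n → Fin m)
                        → length (filterᵇ P (tabulate g)) ≡ count (P ∘ g)
length-filterᵇ-tabulate {zero} P g = refl
length-filterᵇ-tabulate {suc n} P g with P (g zero)
... | true = cong suc (length-filterᵇ-tabulate P (g ∘ suc))
... | false = length-filterᵇ-tabulate P (g ∘ suc)

length-filterᵇ-allFin : ∀ {n} (P : Fin n → Bool) → length (filterᵇ P (allFin n)) ≡ count P
length-filterᵇ-allFin P = length-filterᵇ-tabulate P id

_∖_ : ∀ {n} → (Fin n → Bool) → Fin n → (Fin n → Bool)
(P ∖ x) i = P i ∧ not ⌊ i ≟ x ⌋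

∖-suc : ∀ {n} (P : Fin (suc n) → Bool) x i → ((P ∘ suc) ∖ x) i ≡ (P ∖ suc x) (suc i)
∖-suc P x i with i ≟ x
... | yes _ = refl
... | no _ = refl

count-∖ : ∀ {n} {P : Fin n → Bool} {x} → P x ≡ true → count P ≡ suc (count (P ∖ x))
count-∖ {suc n} {P} {zero} Px rewrite Px =
  cong suc (count-cong λ i → sym (∧-identityʳ (P (suc i))))
count-∖ {suc n} {P} {suc x} Px with P zero
... | true = cong suc (trans (count-∖ {P = P ∘ suc} Px) (cong suc (count-cong (∖-suc P x))))
... | false = trans (count-∖ {P = P ∘ suc} Px) (cong suc (count-cong (∖-suc P x)))

∖-true⁺ : ∀ {n} {P : Fin n → Bool} {x z} → P z ≡ true → z ≢ x → (P ∖ x) z ≡ true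
∖-true⁺ Pz z≢x = ∧-true⁺ Pz (≢⇒not-≟ z≢x)

∖-true⁻ : ∀ {n} {P : Fin n → Bool} {x z} → (P ∖ x) z ≡ true → P z ≡ true × z ≢ x
∖-true⁻ {P = P} {z = z} e with ∧-true⁻ (P z) e
... | Pz , avoids = Pz , not-≟⇒≢ avoids

count-unique : ∀ {n} {P : Fin n → Bool} {x} → P x ≡ true → (∀ y → P y ≡ true → y ≡ x) → count P ≡ 1
count-unique {P = P} {x} Px unique = trans (count-∖ {P = P} Px) (cong suc (count-none only-x))
  where
  only-x : ∀ y → (P ∖ x) y ≡ false
  only-x y = ≢true⇒false λ P∖x → let Py , y≢x = ∖-true⁻ {P = P} P∖x in y≢x (unique y Py)

PairedBy : ∀ {n} → (Fin n → Bool) → (Fin n → Fin n) → Set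
PairedBy P π = ∀ y → P y ≡ true → P (π y) ≡ true × π (π y) ≡ y × π y ≢ y

module _ {n} {P : Fin n → Bool} {π : Fin n → Fin n} (paired : PairedBy P π) {y} (Py : P y ≡ true) where

  count-∖-pair : count P ≡ suc (suc (count ((P ∖ y) ∖ π y)))
  count-∖-pair with paired y Py
  ... | Pπy , _ , πy≢y = trans (count-∖ {P = P} Py) (cong suc (count-∖ {P = P ∖ y} (∖-true⁺ {P = P} Pπy πy≢y)))

  PairedBy-∖-pair : PairedBy ((P ∖ y) ∖ π y) π
  PairedBy-∖-pair z Qz with ∖-true⁻ {P = P ∖ y} Qz
  ... | Rz , z≢πy with ∖-true⁻ {P = P} Rz
  ...   | Pz , z≢y with paired z Pz | paired y Py
  ...     | Pπz , ππz≡z , πz≢z | _ , ππy≡y , _ =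
    ∖-true⁺ {P = P ∖ y} (∖-true⁺ {P = P} Pπz λ πz≡y → z≢πy (trans (sym ππz≡z) (cong π πz≡y)))
            (λ πz≡πy → z≢y (trans (sym ππz≡z) (trans (cong π πz≡πy) ππy≡y)))
    , ππz≡z , πz≢z

even-count′ : ∀ {n} k {P : Fin n → Bool} {π} → PairedBy P π → count P ≡ k → Even k
even-count′ zero _ _ = 2 ∣0
even-count′ (suc k) paired eq with count-suc⇒∃ eq
... | y , Py with k | trans (sym eq) (count-∖-pair paired {y} Py)
...   | suc k | eq′ =
  ∣m∣n⇒∣m+n ∣-refl (even-count′ k (PairedBy-∖-pair paired {y} Py) (suc-injective (suc-injective (sym eq′))))

even-count : ∀ {n} {P : Fin n → Bool} {π} → PairedBy P π → Even (count P)
even-count paired = even-count′ _ paired refl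

odd-1 : Odd 1
odd-1 2∣1 with ∣1⇒≡1 2∣1
... | ()

opaque
  choice : ∀ {n} {P : Fin n → Set} → (∀ x → Dec (P x)) → Fin n → Fin n
  choice P? default with any? P?
  ... | yes (x , _) = x
  ... | no _ = default

  choice-spec : ∀ {n} {P : Fin n → Set} (P? : ∀ x → Dec (P x)) default → ∃ P → P (choice P? default)
  choice-spec P? _ ∃P with any? P?
  ... | yes (_ , Px) = Px
  ... | no ¬∃P = ⊥-elim (¬∃P ∃P)

argmin : ∀ {k} (g : Fin (suc k) → ℕ) → ∃ λ i → ∀ j → g i ≤ g j
argmin {zero} g = zero , λ { zero → ≤-refl }
argmin {suc k} g with argmin (g ∘ suc)
... | i , min with g zero ≤? g (suc i)
...   | yes g0≤ = zero , λ { zero → ≤-refl ; (suc j) → ≤-trans g0≤ (min j) }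
...   | no g0≰ = suc i , λ { zero → <⇒≤ (≰⇒> g0≰) ; (suc j) → min j }

least : (ℕ → Bool) → ℕ → ℕ
least p zero = zero
least p (suc b) = if p 0 then 0 else suc (least (p ∘ suc) b)

least-holds : ∀ (p : ℕ → Bool) b → p b ≡ true → p (least p b) ≡ true
least-holds p zero pb = pb
least-holds p (suc b) pb with p 0 in p0
... | true = p0
... | false = least-holds (p ∘ suc) b pb

least-minimal : ∀ (p : ℕ → Bool) b {j} → j < least p b → p j ≡ false
least-minimal p (suc b) {j} j< with p 0 in p0
least-minimal p (suc b) {zero} _ | false = p0
least-minimal p (suc b) {suc j} (s≤s j<) | false = least-minimal (p ∘ suc) b j<

swap : ∀ {n} → Fin n → Fin n → (Fin n → Fin n) → Fin n → Fin n
swap a b π y with y ≟ a | y ≟ b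
... | yes _ | _ = b
... | no _ | yes _ = a
... | no _ | no _ = π y

swap-a : ∀ {n} (a b : Fin n) π → swap a b π a ≡ b
swap-a a b π with a ≟ a
... | yes _ = refl
... | no a≢a = ⊥-elim (a≢a refl)

swap-b : ∀ {n} {a b : Fin n} π → a ≢ b → swap a b π b ≡ a
swap-b {a = a} {b} π a≢b with b ≟ a | b ≟ b
... | yes b≡a | _ = ⊥-elim (a≢b (sym b≡a))
... | no _ | yes _ = refl
... | no _ | no b≢b = ⊥-elim (b≢b refl)

swap-other : ∀ {n} {a b y : Fin n} π → y ≢ a → y ≢ b → swap a b π y ≡ π y
swap-other {a = a} {b} {y} π y≢a y≢b with y ≟ a | y ≟ b
... | yes y≡a | _ = ⊥-elim (y≢a y≡a)
... | no _ | yes y≡b = ⊥-elim (y≢b y≡b)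
... | no _ | no _ = refl

by-exhaustion : {A : Set} (a? : Dec A) → {True a?} → A
by-exhaustion a? {holds} = toWitness holds

-- Vertex 0 of C5 plays the top of a block: height i is its distance from 0, and below, above
-- and across pick the neighbour of smaller, larger and equal height (junk where there is none).
height : Fin 5 → ℕ
height i = toℕ i ⊓ (5 ∸ toℕ i)

below above across : Fin 5 → Fin 5
below  = lookup (# 0 ∷ # 0 ∷ # 1 ∷ # 4 ∷ # 0 ∷ [])
above  = lookup (# 0 ∷ # 2 ∷ # 0 ∷ # 0 ∷ # 3 ∷ [])
across = lookup (# 0 ∷ # 0 ∷ # 3 ∷ # 2 ∷ # 0 ∷ [])

rotate : Fin 5 → Fin 5 → Fin 5
rotate i a = (toℕ i + toℕ a) mod 5

C5adj? : ∀ a b → Dec (C5adj a b ≡ true)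
C5adj? a b = C5adj a b ≟ᵇ true

rotate-zero : ∀ i → rotate i zero ≡ i
rotate-zero = by-exhaustion (all? λ i → rotate i zero ≟ i)

rotate-injective : ∀ i a b → rotate i a ≡ rotate i b → a ≡ b
rotate-injective = by-exhaustion (all? λ i → all? λ a → all? λ b → rotate i a ≟ rotate i b →-dec a ≟ b)

rotate-surjective : ∀ i b → ∃ λ a → rotate i a ≡ b
rotate-surjective = by-exhaustion (all? λ i → all? λ b → any? λ a → rotate i a ≟ b)

C5adj-rotate : ∀ i a b → C5adj (rotate i a) (rotate i b) ≡ C5adj a b
C5adj-rotate = by-exhaustion (all? λ i → all? λ a → all? λ b → C5adj (rotate i a) (rotate i b) ≟ᵇ C5adj a b)

C5-neighbour : ∀ a → ∃ λ b → C5adj a b ≡ true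
C5-neighbour = by-exhaustion (all? λ a → any? λ b → C5adj? a b)

height≡0⇒zero : ∀ a → height a ≡ 0 → a ≡ zero
height≡0⇒zero = by-exhaustion (all? λ a → height a ≟ℕ 0 →-dec a ≟ zero)

height≡2⇒≢zero : ∀ a → height a ≡ 2 → a ≢ zero
height≡2⇒≢zero = by-exhaustion (all? λ a → height a ≟ℕ 2 →-dec ¬? (a ≟ zero))

below-unique : ∀ a b → C5adj a b ≡ true → suc (height b) ≡ height a → b ≡ below a
below-unique = by-exhaustion (all? λ a → all? λ b →
  C5adj? a b →-dec (suc (height b) ≟ℕ height a →-dec b ≟ below a))

across-unique : ∀ a b → C5adj a b ≡ true → height b ≡ height a → b ≡ across a
across-unique = by-exhaustion (all? λ a → all? λ b →
  C5adj? a b →-dec (height b ≟ℕ height a →-dec b ≟ across a))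

level-edge-height : ∀ a b → C5adj a b ≡ true → height b ≡ height a → height a ≡ 2
level-edge-height = by-exhaustion (all? λ a → all? λ b →
  C5adj? a b →-dec (height b ≟ℕ height a →-dec height a ≟ℕ 2))

above-unique : ∀ a b → a ≢ zero → C5adj a b ≡ true → height b ≡ suc (height a) → b ≡ above a
above-unique = by-exhaustion (all? λ a → all? λ b →
  ¬? (a ≟ zero) →-dec (C5adj? a b →-dec (height b ≟ℕ suc (height a) →-dec b ≟ above a)))

C5adj-across : ∀ a → height a ≡ 2 → C5adj a (across a) ≡ true × height (across a) ≡ 2
C5adj-across = by-exhaustion (all? λ a → height a ≟ℕ 2 →-dec (C5adj? a (across a) ×-dec height (across a) ≟ℕ 2))

C5adj-above : ∀ a → a ≢ zero → height a ≢ 2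
            → C5adj a (above a) ≡ true × height (above a) ≡ suc (height a) × height (above a) ≡ 2
C5adj-above = by-exhaustion (all? λ a → ¬? (a ≟ zero) →-dec (¬? (height a ≟ℕ 2) →-dec
  (C5adj? a (above a) ×-dec (height (above a) ≟ℕ suc (height a) ×-dec height (above a) ≟ℕ 2))))

above-below : ∀ a → height a ≡ 2 → above (below a) ≡ a
above-below = by-exhaustion (all? λ a → height a ≟ℕ 2 →-dec above (below a) ≟ a)

below-≢zero : ∀ a → height a ≡ 2 → below a ≢ zero
below-≢zero = by-exhaustion (all? λ a → height a ≟ℕ 2 →-dec ¬? (below a ≟ zero))

height-below≢2 : ∀ a → height a ≡ 2 → height (below a) ≢ 2
height-below≢2 = by-exhaustion (all? λ a → height a ≟ℕ 2 →-dec ¬? (height (below a) ≟ℕ 2))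

below-below : ∀ a → height a ≡ 2 → below (below a) ≡ zero
below-below = by-exhaustion (all? λ a → height a ≟ℕ 2 →-dec below (below a) ≟ zero)

below-across : ∀ a → height a ≡ 2 → below a ≢ below (across a)
below-across = by-exhaustion (all? λ a → height a ≟ℕ 2 →-dec ¬? (below a ≟ below (across a)))

C5-arc : ∀ b → Star (λ i j → C5adj i j ≡ true × height j < height b) b zero
C5-arc zero = ε
C5-arc (suc zero) = (refl , s≤s z≤n) ◅ ε
C5-arc (suc (suc zero)) = _◅_ {j = # 1} (refl , s≤s (s≤s z≤n)) ((refl , s≤s z≤n) ◅ ε)
C5-arc (suc (suc (suc zero))) = _◅_ {j = # 4} (refl , s≤s (s≤s z≤n)) ((refl , s≤s z≤n) ◅ ε)
C5-arc (suc (suc (suc (suc zero)))) = (refl , s≤s z≤n) ◅ ε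

succ : Fin 4 → Fin 4
succ c = suc (toℕ c) mod 4

succ-≢ : ∀ c → succ c ≢ c
succ-≢ = by-exhaustion (all? λ c → ¬? (succ c ≟ c))

succ²-≢ : ∀ c → succ (succ c) ≢ c
succ²-≢ = by-exhaustion (all? λ c → ¬? (succ (succ c) ≟ c))

succ³-≢ : ∀ c → succ (succ (succ c)) ≢ c
succ³-≢ = by-exhaustion (all? λ c → ¬? (succ (succ (succ c)) ≟ c))

succ-≢-succ² : ∀ c → succ c ≢ succ (succ c)
succ-≢-succ² = by-exhaustion (all? λ c → ¬? (succ c ≟ succ (succ c)))

four-colours : ∀ (a b c d e : Fin 4) → a ≢ b → a ≢ c → a ≢ d → b ≢ c → b ≢ d → c ≢ d
             → e ≢ a → e ≢ c → e ≢ d → e ≡ b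
four-colours = by-exhaustion (all? λ a → all? λ b → all? λ c → all? λ d → all? λ e →
  ¬? (a ≟ b) →-dec (¬? (a ≟ c) →-dec (¬? (a ≟ d) →-dec (¬? (b ≟ c) →-dec (¬? (b ≟ d) →-dec
  (¬? (c ≟ d) →-dec (¬? (e ≟ a) →-dec (¬? (e ≟ c) →-dec (¬? (e ≟ d) →-dec e ≟ b)))))))))

module Graphs {n} (G : Graph n) where

  infix 4 _~_ _∈ᵛ_

  _~_ : Fin n → Fin n → Set
  x ~ y = adj G x y ≡ true

  _∈ᵛ_ : Fin n → Subgraph G → Set
  x ∈ᵛ H = V H x ≡ true

  ~-sym : ∀ {x y} → x ~ y → y ~ x
  ~-sym {x} {y} x~y = trans (Graph.sym G y x) x~y

  ~-irrefl : ∀ {x y} → x ~ y → x ≢ y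
  ~-irrefl {x} x~x refl = true≢false (trans (sym x~x) (irrefl G x))

  nbrCount≡count : ∀ {k} (ψ : Coloring n k) x i → nbrCount G ψ x i ≡ count (λ y → adj G x y ∧ ⌊ ψ y ≟ i ⌋)
  nbrCount≡count ψ x i = length-filterᵇ-allFin (λ y → adj G x y ∧ ⌊ ψ y ≟ i ⌋)

  walk-length : ∀ {H : Subgraph G} {ok x y} → Walk H ok x y → ℕ
  walk-length (here _ _) = 0
  walk-length (step _ _ w) = suc (walk-length w)

  avoiding : Fin n → Fin n → Bool
  avoiding c x = not ⌊ x ≟ c ⌋

  module _ {H : Subgraph G} {ok : Fin n → Bool} where

    walk-start : ∀ {x y} → Walk H ok x y → ok x ≡ true × x ∈ᵛ H
    walk-start (here x∈H okx) = okx , x∈H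
    walk-start (step okx xEy _) = okx , E⊆V H _ _ xEy

    walk-end : ∀ {x y} → Walk H ok x y → ok y ≡ true × y ∈ᵛ H
    walk-end (here y∈H oky) = oky , y∈H
    walk-end (step _ _ w) = walk-end w

    infixr 5 _++ʷ_

    _++ʷ_ : ∀ {x y z} → Walk H ok x y → Walk H ok y z → Walk H ok x z
    here _ _ ++ʷ w = w
    step okx xEy v ++ʷ w = step okx xEy (v ++ʷ w)

    reverseʷ : ∀ {x y} → Walk H ok x y → Walk H ok y x
    reverseʷ (here x∈H okx) = here x∈H okx
    reverseʷ (step {x} {y} okx xEy w) =
      reverseʷ w ++ʷ step (proj₁ (walk-start w)) (trans (E-sym H y x) xEy) (here (E⊆V H x y xEy) okx)

  mapʷ : ∀ {H H' : Subgraph G} {ok ok' x y} → H ⊑ H'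
       → (∀ z → z ∈ᵛ H → ok z ≡ true → ok' z ≡ true) → Walk H ok x y → Walk H' ok' x y
  mapʷ (V⊆ , _) ok⇒ok' (here {x} x∈H okx) = here (V⊆ x x∈H) (ok⇒ok' x x∈H okx)
  mapʷ {H} H⊑H'@(_ , E⊆) ok⇒ok' (step {x} {y} okx xEy w) =
    step (ok⇒ok' x (E⊆V H x y xEy) okx) (E⊆ x y xEy) (mapʷ H⊑H' ok⇒ok' w)

  liftʷ : ∀ {H H' : Subgraph G} {ok x y} → H ⊑ H' → Walk H ok x y → Walk H' ok x y
  liftʷ H⊑H' = mapʷ H⊑H' (λ _ _ ok → ok)

  ⊑-refl : ∀ {H : Subgraph G} → H ⊑ H
  ⊑-refl = (λ _ v → v) , (λ _ _ e → e)

  ⊑-trans : ∀ {H₁ H₂ H₃ : Subgraph G} → H₁ ⊑ H₂ → H₂ ⊑ H₃ → H₁ ⊑ H₃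
  ⊑-trans (V₁₂ , E₁₂) (V₂₃ , E₂₃) = (λ v → V₂₃ v ∘ V₁₂ v) , (λ x y → E₂₃ x y ∘ E₁₂ x y)

  ⊑-stable : ∀ {H₁ H₂ : Subgraph G} → ¬ ¬ (H₁ ⊑ H₂) → H₁ ⊑ H₂
  ⊑-stable ¬¬H₁⊑H₂ = (λ v v∈ → bool-stable λ ¬v∈ → ¬¬H₁⊑H₂ λ (V⊆ , _) → ¬v∈ (V⊆ v v∈))
                    , (λ x y e → bool-stable λ ¬e → ¬¬H₁⊑H₂ λ (_ , E⊆) → ¬e (E⊆ x y e))
    where
    bool-stable : ∀ {b} → ¬ ¬ (b ≡ true) → b ≡ true
    bool-stable {true} _ = refl
    bool-stable {false} ¬¬b = ⊥-elim (¬¬b λ ())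

  infixl 30 _∪_

  _∪_ : Subgraph G → Subgraph G → Subgraph G
  H₁ ∪ H₂ = record
    { V = λ v → V H₁ v ∨ V H₂ v
    ; E = λ x y → E H₁ x y ∨ E H₂ x y
    ; E-sym = λ x y → cong₂ _∨_ (E-sym H₁ x y) (E-sym H₂ x y)
    ; E⊆adj = λ x y e → [ E⊆adj H₁ x y , E⊆adj H₂ x y ]′ (∨-true⁻ (E H₁ x y) e)
    ; E⊆V = λ x y e → [ ∨-trueˡ (V H₂ x) ∘ E⊆V H₁ x y , ∨-trueʳ (V H₁ x) ∘ E⊆V H₂ x y ]′
                        (∨-true⁻ (E H₁ x y) e) }

  ⊑-∪ˡ : ∀ H₁ H₂ → H₁ ⊑ H₁ ∪ H₂
  ⊑-∪ˡ _ H₂ = (λ v → ∨-trueˡ (V H₂ v)) , (λ x y → ∨-trueˡ (E H₂ x y))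

  ⊑-∪ʳ : ∀ H₁ H₂ → H₂ ⊑ H₁ ∪ H₂
  ⊑-∪ʳ H₁ _ = (λ v → ∨-trueʳ (V H₁ v)) , (λ x y → ∨-trueʳ (E H₁ x y))

  ∪-elim : ∀ H₁ H₂ {x} {A : Set} → x ∈ᵛ H₁ ∪ H₂ → (x ∈ᵛ H₁ → A) → (x ∈ᵛ H₂ → A) → A
  ∪-elim H₁ _ {x} x∈ f g = [ f , g ]′ (∨-true⁻ (V H₁ x) x∈)

  Nonseparable : Subgraph G → Set
  Nonseparable H = Connected H × NoCutVertex H

  walk-avoiding : ∀ {K} → Nonseparable K → ∀ c {a b} → a ∈ᵛ K → b ∈ᵛ K → a ≢ c → b ≢ c
                → Walk K (avoiding c) a b
  walk-avoiding {K} (conn , no-cut) c {a} {b} a∈K b∈K a≢c b≢c with V K c in c∈K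
  ... | true = no-cut c c∈K a b a∈K b∈K a≢c b≢c
  ... | false = mapʷ (⊑-refl {K}) (λ z z∈K _ → ≢⇒not-≟ λ { refl → true≢false (trans (sym z∈K) c∈K) })
                     (proj₂ conn a b a∈K b∈K)

  module _ {B H : Subgraph G} (B⊑H : B ⊑ H) where

    connected-if-anchored : Connected B → (∀ x → x ∈ᵛ H → ∃ λ b → b ∈ᵛ B × Walk H (λ _ → true) x b)
                          → Connected H
    connected-if-anchored ((b₀ , b₀∈B) , conn) anchor = (b₀ , proj₁ B⊑H b₀ b₀∈B) , walk
      where
      to-b₀ : ∀ x → x ∈ᵛ H → Walk H (λ _ → true) x b₀
      to-b₀ x x∈H with anchor x x∈H
      ... | b , b∈B , x⇝b = x⇝b ++ʷ liftʷ B⊑H (conn b b₀ b∈B b₀∈B)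
      walk : ∀ x y → x ∈ᵛ H → y ∈ᵛ H → Walk H (λ _ → true) x y
      walk x y x∈H y∈H = to-b₀ x x∈H ++ʷ reverseʷ (to-b₀ y y∈H)

    no-cut-if-anchored : Nonseparable B
                       → (∀ c x → x ∈ᵛ H → x ≢ c → ∃ λ b → b ∈ᵛ B × b ≢ c × Walk H (avoiding c) x b)
                       → NoCutVertex H
    no-cut-if-anchored nonsep anchor c _ x y x∈H y∈H x≢c y≢c
      with anchor c x x∈H x≢c | anchor c y y∈H y≢c
    ... | bx , bx∈B , bx≢c , x⇝bx | by , by∈B , by≢c , y⇝by =
      x⇝bx ++ʷ liftʷ B⊑H (walk-avoiding nonsep c bx∈B by∈B bx≢c by≢c) ++ʷ reverseʷ y⇝by

  ∪-nonseparable : ∀ {H₁ H₂} → Nonseparable H₁ → Nonseparable H₂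
                 → ∀ {u w} → u ≢ w → u ∈ᵛ H₁ → w ∈ᵛ H₁ → u ∈ᵛ H₂ → w ∈ᵛ H₂
                 → Nonseparable (H₁ ∪ H₂)
  ∪-nonseparable {H₁} {H₂} ns₁ ns₂@(conn₂ , _) {u} {w} u≢w u∈₁ w∈₁ u∈₂ w∈₂ =
    connected-if-anchored (⊑-∪ˡ H₁ H₂) (proj₁ ns₁) reach
    , no-cut-if-anchored (⊑-∪ˡ H₁ H₂) ns₁ reach-avoiding
    where
    reach : ∀ x → x ∈ᵛ H₁ ∪ H₂ → ∃ λ b → b ∈ᵛ H₁ × Walk (H₁ ∪ H₂) (λ _ → true) x b
    reach x x∈ = ∪-elim H₁ H₂ x∈ (λ x∈₁ → x , x∈₁ , here x∈ refl)
                               (λ x∈₂ → u , u∈₁ , liftʷ (⊑-∪ʳ H₁ H₂) (proj₂ conn₂ x u x∈₂ u∈₂))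
    reach-avoiding : ∀ c x → x ∈ᵛ H₁ ∪ H₂ → x ≢ c
                   → ∃ λ b → b ∈ᵛ H₁ × b ≢ c × Walk (H₁ ∪ H₂) (avoiding c) x b
    reach-avoiding c x x∈ x≢c = ∪-elim H₁ H₂ x∈
      (λ x∈₁ → x , x∈₁ , x≢c , here x∈ (≢⇒not-≟ x≢c))
      (λ x∈₂ → let b , b∈₁ , b∈₂ , b≢c = u-or-w in
               b , b∈₁ , b≢c , liftʷ (⊑-∪ʳ H₁ H₂) (walk-avoiding ns₂ c x∈₂ b∈₂ x≢c b≢c))
      where
      u-or-w : ∃ λ b → b ∈ᵛ H₁ × b ∈ᵛ H₂ × b ≢ c
      u-or-w with u ≟ c
      ... | no u≢c = u , u∈₁ , u∈₂ , u≢c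
      ... | yes refl = w , w∈₁ , w∈₂ , λ w≡u → u≢w (sym w≡u)

  point : Fin n → Subgraph G
  point x = record
    { V = λ z → ⌊ z ≟ x ⌋ ; E = λ _ _ → false ; E-sym = λ _ _ → refl
    ; E⊆adj = λ _ _ () ; E⊆V = λ _ _ () }

  point-nonseparable : ∀ x → Nonseparable (point x)
  point-nonseparable x = ((x , ≟-refl x) , walk) , no-cut
    where
    walk : ∀ a b → a ∈ᵛ point x → b ∈ᵛ point x → Walk (point x) (λ _ → true) a b
    walk a b a∈ b∈ with ≟-true⁻ {x = a} a∈ | ≟-true⁻ {x = b} b∈
    ... | refl | refl = here a∈ refl
    no-cut : NoCutVertex (point x)
    no-cut c c∈ a b a∈ _ a≢c _ = ⊥-elim (a≢c (trans (≟-true⁻ {x = a} a∈) (sym (≟-true⁻ {x = c} c∈))))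

  edge : ∀ {x y} → x ~ y → Subgraph G
  edge {x} {y} x~y = record
    { V = λ z → ⌊ z ≟ x ⌋ ∨ ⌊ z ≟ y ⌋
    ; E = λ a b → (⌊ a ≟ x ⌋ ∧ ⌊ b ≟ y ⌋) ∨ (⌊ a ≟ y ⌋ ∧ ⌊ b ≟ x ⌋)
    ; E-sym = λ a b → trans (cong₂ _∨_ (∧-comm ⌊ a ≟ x ⌋ _) (∧-comm ⌊ a ≟ y ⌋ _))
                            (∨-comm (⌊ b ≟ y ⌋ ∧ ⌊ a ≟ x ⌋) _)
    ; E⊆adj = λ a b e → [ (λ xy → subst₂ _~_ (sym (proj₁ (pair xy))) (sym (proj₂ (pair xy))) x~y)
                        , (λ yx → subst₂ _~_ (sym (proj₁ (pair yx))) (sym (proj₂ (pair yx))) (~-sym x~y))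
                        ]′ (∨-true⁻ (⌊ a ≟ x ⌋ ∧ ⌊ b ≟ y ⌋) e)
    ; E⊆V = λ a b e → [ ∨-trueˡ ⌊ a ≟ y ⌋ ∘ proj₁ ∘ ∧-true⁻ ⌊ a ≟ x ⌋
                      , ∨-trueʳ ⌊ a ≟ x ⌋ ∘ proj₁ ∘ ∧-true⁻ ⌊ a ≟ y ⌋
                      ]′ (∨-true⁻ (⌊ a ≟ x ⌋ ∧ ⌊ b ≟ y ⌋) e) }
    where
    pair : ∀ {a b u v} → ⌊ a ≟ u ⌋ ∧ ⌊ b ≟ v ⌋ ≡ true → a ≡ u × b ≡ v
    pair {a} {u = u} e with ∧-true⁻ ⌊ a ≟ u ⌋ e
    ... | a≡u , b≡v = ≟-true⁻ a≡u , ≟-true⁻ b≡v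

  module _ {x y} (x~y : x ~ y) where

    edge-start : x ∈ᵛ edge x~y
    edge-start = ∨-trueˡ ⌊ x ≟ y ⌋ (≟-refl x)

    edge-end : y ∈ᵛ edge x~y
    edge-end = ∨-trueʳ ⌊ y ≟ x ⌋ (≟-refl y)

    edge-E : E (edge x~y) x y ≡ true
    edge-E = ∨-trueˡ (⌊ x ≟ y ⌋ ∧ ⌊ y ≟ x ⌋) (∧-true⁺ (≟-refl x) (≟-refl y))

    edge-V⁻ : ∀ {z} → z ∈ᵛ edge x~y → z ≡ x ⊎ z ≡ y
    edge-V⁻ {z} z∈ = [ inj₁ ∘ ≟-true⁻ , inj₂ ∘ ≟-true⁻ ]′ (∨-true⁻ ⌊ z ≟ x ⌋ z∈)

    edge-nonseparable : Nonseparable (edge x~y)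
    edge-nonseparable = ((x , edge-start) , walk) , no-cut
      where
      y⇝x : ∀ {ok} → ok y ≡ true → ok x ≡ true → Walk (edge x~y) ok y x
      y⇝x oky okx = step oky (trans (E-sym (edge x~y) y x) edge-E) (here edge-start okx)
      walk : ∀ a b → a ∈ᵛ edge x~y → b ∈ᵛ edge x~y → Walk (edge x~y) (λ _ → true) a b
      walk a b a∈ b∈ with edge-V⁻ {a} a∈ | edge-V⁻ {b} b∈
      ... | inj₁ refl | inj₁ refl = here a∈ refl
      ... | inj₂ refl | inj₂ refl = here a∈ refl
      ... | inj₁ refl | inj₂ refl = reverseʷ (y⇝x refl refl)
      ... | inj₂ refl | inj₁ refl = y⇝x refl refl
      no-cut : NoCutVertex (edge x~y)
      no-cut c c∈ a b a∈ b∈ a≢c b≢c with edge-V⁻ {a} a∈ | edge-V⁻ {b} b∈ | edge-V⁻ {c} c∈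
      ... | inj₁ refl | inj₁ refl | _ = here a∈ (≢⇒not-≟ a≢c)
      ... | inj₂ refl | inj₂ refl | _ = here a∈ (≢⇒not-≟ a≢c)
      ... | inj₁ refl | inj₂ refl | inj₁ refl = ⊥-elim (a≢c refl)
      ... | inj₁ refl | inj₂ refl | inj₂ refl = ⊥-elim (b≢c refl)
      ... | inj₂ refl | inj₁ refl | inj₁ refl = ⊥-elim (b≢c refl)
      ... | inj₂ refl | inj₁ refl | inj₂ refl = ⊥-elim (a≢c refl)

  module _ {R : Fin n → Fin n → Set} where

    infix 4 _∈⋆_

    _∈⋆_ : ∀ {x y} → Fin n → Star R x y → Set
    _∈⋆_ {x} z ε = z ≡ x
    _∈⋆_ {x} z (_ ◅ p) = z ≡ x ⊎ z ∈⋆ p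

    start∈⋆ : ∀ {x y} (p : Star R x y) → x ∈⋆ p
    start∈⋆ ε = refl
    start∈⋆ (_ ◅ _) = inj₁ refl

    _∈⋆?_ : ∀ {x y} z (p : Star R x y) → Dec (z ∈⋆ p)
    z ∈⋆? ε = z ≟ _
    z ∈⋆? (_ ◅ p) = (z ≟ _) ⊎-dec (z ∈⋆? p)

    Simple : ∀ {x y} → Star R x y → Set
    Simple ε = ⊤
    Simple (_◅_ {x} _ p) = ¬ x ∈⋆ p × Simple p

    suffix : ∀ {x y z} (p : Star R x y) → Simple p → z ∈⋆ p
           → ∃ λ (q : Star R z y) → Simple q × (∀ v → v ∈⋆ q → v ∈⋆ p)
    suffix ε _ refl = ε , tt , λ _ v∈ → v∈
    suffix (r ◅ p) simple (inj₁ refl) = r ◅ p , simple , λ _ v∈ → v∈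
    suffix (_ ◅ p) (_ , simple) (inj₂ z∈p) with suffix p simple z∈p
    ... | q , simple-q , q⊆p = q , simple-q , λ v v∈q → inj₂ (q⊆p v v∈q)

    shortcut : ∀ {x y} (p : Star R x y) → ∃ λ (q : Star R x y) → Simple q × (∀ v → v ∈⋆ q → v ∈⋆ p)
    shortcut ε = ε , tt , λ _ v∈ → v∈
    shortcut (_◅_ {x} r p) with shortcut p
    ... | q , simple-q , q⊆p with x ∈⋆? q
    ...   | yes x∈q = let q′ , simple-q′ , q′⊆q = suffix q simple-q x∈q in
                      q′ , simple-q′ , λ v v∈ → inj₂ (q⊆p v (q′⊆q v v∈))
    ...   | no x∉q =
      r ◅ q , (x∉q , simple-q) , λ { v (inj₁ v≡x) → inj₁ v≡x ; v (inj₂ v∈q) → inj₂ (q⊆p v v∈q) }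

    module _ (R⇒~ : ∀ {a b} → R a b → a ~ b) where

      trace : ∀ {x y} → Star R x y → Subgraph G
      trace {x} ε = point x
      trace (r ◅ p) = edge (R⇒~ r) ∪ trace p

      trace⁻ : ∀ {x y z} (p : Star R x y) → z ∈ᵛ trace p → z ∈⋆ p
      trace⁻ ε z∈ = ≟-true⁻ z∈
      trace⁻ (r ◅ p) z∈ = ∪-elim (edge (R⇒~ r)) (trace p) z∈
        (λ z∈e → [ inj₁ , (λ { refl → inj₂ (start∈⋆ p) }) ]′ (edge-V⁻ (R⇒~ r) z∈e))
        (λ z∈p → inj₂ (trace⁻ p z∈p))

      trace⁺ : ∀ {x y z} (p : Star R x y) → z ∈⋆ p → z ∈ᵛ trace p
      trace⁺ ε refl = ≟-refl _
      trace⁺ (r ◅ p) (inj₁ refl) = proj₁ (⊑-∪ˡ (edge (R⇒~ r)) (trace p)) _ (edge-start (R⇒~ r))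
      trace⁺ (r ◅ p) (inj₂ z∈p) = proj₁ (⊑-∪ʳ (edge (R⇒~ r)) (trace p)) _ (trace⁺ p z∈p)

      private
        lift : ∀ {x y} (r : R x y) {z} (p : Star R y z) {ok a b}
             → Walk (trace p) ok a b → Walk (trace (r ◅ p)) ok a b
        lift r p = liftʷ (⊑-∪ʳ (edge (R⇒~ r)) (trace p))

        first-step : ∀ {x y} (r : R x y) {z} (p : Star R y z) → E (trace (r ◅ p)) x y ≡ true
        first-step r p = ∨-trueˡ (E (trace p) _ _) (edge-E (R⇒~ r))

      walk-to-end : ∀ {x y z ok} (p : Star R x y) → z ∈⋆ p → (∀ v → v ∈⋆ p → ok v ≡ true)
                  → Walk (trace p) ok z y
      walk-to-end ε refl ok = here (≟-refl _) (ok _ refl)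
      walk-to-end (r ◅ p) (inj₁ refl) ok =
        step (ok _ (inj₁ refl)) (first-step r p) (lift r p (walk-to-end p (start∈⋆ p) (λ v → ok v ∘ inj₂)))
      walk-to-end (r ◅ p) (inj₂ z∈p) ok = lift r p (walk-to-end p z∈p (λ v → ok v ∘ inj₂))

      walk-to-an-end : ∀ {x y z} c (p : Star R x y) → Simple p → z ∈⋆ p → z ≢ c
                     → Walk (trace p) (avoiding c) z x ⊎ Walk (trace p) (avoiding c) z y
      walk-to-an-end c ε _ refl z≢c = inj₁ (here (≟-refl _) (≢⇒not-≟ z≢c))
      walk-to-an-end c (r ◅ p) _ (inj₁ refl) z≢c = inj₁ (here (trace⁺ (r ◅ p) (inj₁ refl)) (≢⇒not-≟ z≢c))
      walk-to-an-end c (_◅_ {x} r p) (x∉p , simple) (inj₂ z∈p) z≢c with walk-to-an-end c p simple z∈p z≢c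
      ... | inj₂ z⇝y = inj₂ (lift r p z⇝y)
      ... | inj₁ z⇝x′ with x ≟ c
      ...   | no x≢c = inj₁ (lift r p z⇝x′ ++ʷ
                               step (proj₁ (walk-end z⇝x′)) (trans (E-sym (trace (r ◅ p)) _ x) (first-step r p))
                                    (here (trace⁺ (r ◅ p) (inj₁ refl)) (≢⇒not-≟ x≢c)))
      ...   | yes refl = inj₂ (lift r p (walk-to-end p z∈p (λ v v∈p → ≢⇒not-≟ λ { refl → x∉p v∈p })))

      ear-nonseparable : ∀ {B u w} → Nonseparable B → (p : Star R u w) → Simple p → u ∈ᵛ B → w ∈ᵛ B
                       → Nonseparable (B ∪ trace p)
      ear-nonseparable {B} {u} {w} nsB p simple u∈B w∈B =
        connected-if-anchored B⊑ (proj₁ nsB) reach , no-cut-if-anchored B⊑ nsB reach-avoiding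
        where
        B⊑ = ⊑-∪ˡ B (trace p)
        lift′ : ∀ {ok a b} → Walk (trace p) ok a b → Walk (B ∪ trace p) ok a b
        lift′ = liftʷ (⊑-∪ʳ B (trace p))
        reach : ∀ x → x ∈ᵛ B ∪ trace p → ∃ λ b → b ∈ᵛ B × Walk (B ∪ trace p) (λ _ → true) x b
        reach x x∈ = ∪-elim B (trace p) x∈
          (λ x∈B → x , x∈B , here x∈ refl)
          (λ x∈p → w , w∈B , lift′ (walk-to-end p (trace⁻ p x∈p) (λ _ _ → refl)))
        reach-avoiding : ∀ c x → x ∈ᵛ B ∪ trace p → x ≢ c
                       → ∃ λ b → b ∈ᵛ B × b ≢ c × Walk (B ∪ trace p) (avoiding c) x b
        reach-avoiding c x x∈ x≢c = ∪-elim B (trace p) x∈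
          (λ x∈B → x , x∈B , x≢c , here x∈ (≢⇒not-≟ x≢c))
          (λ x∈p → [ (λ x⇝u → u , u∈B , not-≟⇒≢ (proj₁ (walk-end x⇝u)) , lift′ x⇝u)
                   , (λ x⇝w → w , w∈B , not-≟⇒≢ (proj₁ (walk-end x⇝w)) , lift′ x⇝w)
                   ]′ (walk-to-an-end c p simple (trace⁻ p x∈p) x≢c))

  size : Subgraph G → ℕ
  size H = count (V H) + ∑ λ u → count (E H u)

  size-bound : ∀ H → size H ≤ n + n * n
  size-bound H = +-mono-≤ (count≤n (V H)) (∑-≤-* n λ u → count≤n (E H u))

  size-mono-< : ∀ {H H'} → H ⊑ H' → ¬ (H' ⊑ H) → size H < size H'
  size-mono-< {H} {H'} (V⊆ , E⊆) H'⋢H = decidable-stable (size H <? size H') λ ¬lt →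
    H'⋢H ((λ v v∈H' → contains (V H v) λ v∉H → ¬lt (+-mono-<-≤ (count-mono-< V⊆ v v∉H v∈H') E-mono))
         , (λ x y e∈H' → contains (E H x y) λ e∉H →
              ¬lt (+-mono-≤-< V-mono (∑-mono-< (λ u → count-mono-≤ (E⊆ u)) x
                                                (count-mono-< (E⊆ x) y e∉H e∈H')))))
    where
    contains : ∀ b → ¬ (b ≡ false) → b ≡ true
    contains true _ = refl
    contains false b≢false = ⊥-elim (b≢false refl)
    V-mono = count-mono-≤ V⊆
    E-mono = ∑-mono-≤ λ u → count-mono-≤ (E⊆ u)

  BlockAbove : Subgraph G → Set
  BlockAbove H = ∃ λ B → IsBlock B × H ⊑ B

  block-if-nothing-bigger : ∀ {H} → Nonseparable H
                          → (∀ {H'} → H ⊑ H' → Nonseparable H' → size H < size H' → ⊥) → IsBlock H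
  block-if-nothing-bigger {H} (conn , no-cut) nothing-bigger =
    conn , no-cut , λ H' H⊑H' conn' no-cut' → ⊑-stable {H'} {H} λ H'⋢H →
      nothing-bigger H⊑H' (conn' , no-cut') (size-mono-< {H} {H'} H⊑H' H'⋢H)

  -- Blocks exist only up to double negation: a strictly larger nonseparable subgraph has
  -- strictly larger size, and sizes are bounded by n + n * n.
  block-above′ : ∀ k {H} → n + n * n ≤ size H + k → Nonseparable H → ¬ ¬ BlockAbove H
  block-above′ zero {H} bound nsH no-block =
    no-block (H , block-if-nothing-bigger nsH (λ {H'} _ _ lt → <⇒≱ lt (≤-trans (size-bound H') bound′)) , ⊑-refl {H})
    where bound′ = ≤-trans bound (≤-reflexive (+-identityʳ (size H)))
  block-above′ (suc k) {H} bound nsH no-block =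
    no-block (H , block-if-nothing-bigger nsH bigger-has-block , ⊑-refl {H})
    where
    bigger-has-block : ∀ {H'} → H ⊑ H' → Nonseparable H' → size H < size H' → ⊥
    bigger-has-block {H'} H⊑H' nsH' lt =
      block-above′ k (≤-trans bound (≤-trans (≤-reflexive (+-suc (size H) k)) (+-monoˡ-≤ k lt))) nsH'
        λ (B , isB , H'⊑B) → no-block (B , isB , ⊑-trans {H} {H'} {B} H⊑H' H'⊑B)

  block-above : ∀ {H} → Nonseparable H → ¬ ¬ BlockAbove H
  block-above {H} = block-above′ (n + n * n) (m≤n+m _ (size H))

  block-absorbs : ∀ {B H} → IsBlock B → Nonseparable (B ∪ H) → H ⊑ B
  block-absorbs {B} {H} (_ , _ , maximal) (conn , no-cut) =
    ⊑-trans {H} {B ∪ H} {B} (⊑-∪ʳ B H) (maximal (B ∪ H) (⊑-∪ˡ B H) conn no-cut)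

  block-nonseparable : ∀ {B} → IsBlock B → Nonseparable B
  block-nonseparable (conn , no-cut , _) = conn , no-cut

  edge-in-block : ∀ {x y} → x ~ y → ¬ ¬ (∃ λ B → IsBlock B × x ∈ᵛ B × y ∈ᵛ B)
  edge-in-block x~y = ¬¬-map (λ (B , isB , (V⊆ , _)) → B , isB , V⊆ _ (edge-start x~y) , V⊆ _ (edge-end x~y))
                             (block-above (edge-nonseparable x~y))

  vertex-in-block : ∀ x → ¬ ¬ (∃ λ B → IsBlock B × x ∈ᵛ B)
  vertex-in-block x = ¬¬-map (λ (B , isB , (V⊆ , _)) → B , isB , V⊆ x (≟-refl x))
                             (block-above (point-nonseparable x))

  blocks-sharing-two-vertices : ∀ {B B'} → IsBlock B → IsBlock B' → ∀ {u w} → u ≢ w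
                              → u ∈ᵛ B → w ∈ᵛ B → u ∈ᵛ B' → w ∈ᵛ B' → B' ⊑ B
  blocks-sharing-two-vertices isB isB' u≢w u∈B w∈B u∈B' w∈B' =
    block-absorbs isB (∪-nonseparable (block-nonseparable isB) (block-nonseparable isB') u≢w u∈B w∈B u∈B' w∈B')

  block-induced : ∀ {B u w} → IsBlock B → u ∈ᵛ B → w ∈ᵛ B → u ~ w → E B u w ≡ true
  block-induced {B} {u} {w} isB u∈B w∈B u~w =
    proj₂ (block-absorbs isB (ear-nonseparable id (block-nonseparable isB) path simple u∈B w∈B))
          u w (∨-trueˡ false (edge-E u~w))
    where
    path : Star _~_ u w
    path = u~w ◅ ε
    simple : Simple path
    simple = (λ u≡w → ~-irrefl u~w u≡w) , tt

  External : Subgraph G → Fin n → Fin n → Set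
  External B a b = a ~ b × ¬ (a ∈ᵛ B × b ∈ᵛ B)

  -- Once shortcut, such a path is an ear of B and hence lies in B, yet its first edge leaves B.
  no-external-path : ∀ {B u w} → IsBlock B → u ∈ᵛ B → w ∈ᵛ B → u ≢ w → ¬ Star (External B) u w
  no-external-path {B} isB u∈B w∈B u≢w p with shortcut p
  ... | ε , _ , _ = u≢w refl
  ... | q@(_◅_ {j = y} (_ , not-both) _) , simple , _ =
    not-both (u∈B , proj₁ (block-absorbs isB (ear-nonseparable proj₁ (block-nonseparable isB) q simple u∈B w∈B))
                            y (trace⁺ proj₁ q (inj₂ (start∈⋆ _))))

module Levels {n} (G : Graph n) where

  open Graphs G

  record Levelling (r : Fin n) : Set where
    field
      level : Fin n → ℕ
      level-root : level r ≡ 0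
      level≡0 : ∀ {x} → level x ≡ 0 → x ≡ r
      level-adj : ∀ {x y} → x ~ y → level x ≤ suc (level y)
      parent-exists : ∀ {x} → x ≢ r → ∃ λ y → x ~ y × suc (level y) ≡ level x

  module _ (r : Fin n) where

    within : ℕ → Fin n → Bool
    within zero x = ⌊ x ≟ r ⌋
    within (suc k) x = within k x ∨ ⌊ any? (λ y → (adj G x y ∧ within k y) ≟ᵇ true) ⌋

    within-step : ∀ k {x y} → x ~ y → within k y ≡ true → within (suc k) x ≡ true
    within-step k {x} {y} x~y y-within =
      ∨-trueʳ (within k x) (⌊⌋-any (y , ∧-true⁺ x~y y-within))
      where
      ⌊⌋-any : ∀ {P : Fin n → Bool} → ∃ (λ y → P y ≡ true) → ⌊ any? (λ y → P y ≟ᵇ true) ⌋ ≡ true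
      ⌊⌋-any {P} found with any? (λ y → P y ≟ᵇ true)
      ... | yes _ = refl
      ... | no none = ⊥-elim (none found)

    within-suc⁻ : ∀ k {x} → within (suc k) x ≡ true → within k x ≡ true ⊎ ∃ λ y → x ~ y × within k y ≡ true
    within-suc⁻ k {x} e with within k x | any? (λ y → (adj G x y ∧ within k y) ≟ᵇ true)
    ... | true | _ = inj₁ refl
    ... | false | yes (y , e′) = inj₂ (y , ∧-true⁻ (adj G x y) e′)

    within-walk : ∀ {x} (w : Walk (whole G) (λ _ → true) x r) → within (walk-length w) x ≡ true
    within-walk (here _ _) = ≟-refl r
    within-walk (step _ x~y w) = within-step (walk-length w) x~y (within-walk w)

    levelling : (∀ x → Walk (whole G) (λ _ → true) x r) → Levelling r
    levelling walk-to-r = record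
      { level = level ; level-root = n≤0⇒n≡0 (level-minimal r (≟-refl r))
      ; level≡0 = level≡0 ; level-adj = level-adj ; parent-exists = parent-exists }
      where
      level : Fin n → ℕ
      level x = least (λ k → within k x) (walk-length (walk-to-r x))

      level-within : ∀ x → within (level x) x ≡ true
      level-within x = least-holds (λ k → within k x) (walk-length (walk-to-r x)) (within-walk (walk-to-r x))

      level-minimal : ∀ x {j} → within j x ≡ true → level x ≤ j
      level-minimal x {j} x-within with level x ≤? j
      ... | yes ≤j = ≤j
      ... | no ≰j = ⊥-elim (true≢false (trans (sym x-within)
                              (least-minimal (λ k → within k x) (walk-length (walk-to-r x)) (≰⇒> ≰j))))

      level≡0 : ∀ {x} → level x ≡ 0 → x ≡ r
      level≡0 {x} eq = ≟-true⁻ (subst (λ k → within k x ≡ true) eq (level-within x))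

      level-adj : ∀ {x y} → x ~ y → level x ≤ suc (level y)
      level-adj {x} {y} x~y = level-minimal x (within-step (level y) x~y (level-within y))

      parent-exists : ∀ {x} → x ≢ r → ∃ λ y → x ~ y × suc (level y) ≡ level x
      parent-exists {x} x≢r with level x in eq | level-within x
      ... | zero | _ = ⊥-elim (x≢r (level≡0 eq))
      ... | suc k | within-suc with within-suc⁻ k within-suc
      ...   | inj₁ within-k = ⊥-elim (<-irrefl refl (subst (_≤ k) eq (level-minimal x within-k)))
      ...   | inj₂ (y , x~y , y-within) =
        y , x~y , cong suc (≤-antisym (level-minimal y y-within) (s≤s⁻¹ (subst (_≤ suc (level y)) eq (level-adj x~y))))

  module Tree {r} (levels : Levelling r) where

    open Levelling levels public

    parent : Fin n → Fin n
    parent x = choice (λ y → (adj G x y ≟ᵇ true) ×-dec (suc (level y) ≟ℕ level x)) x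

    parent-spec : ∀ {x} → x ≢ r → x ~ parent x × suc (level (parent x)) ≡ level x
    parent-spec x≢r = choice-spec _ _ (parent-exists x≢r)

    Sibling : Fin n → Fin n → Set
    Sibling x s = x ~ s × level s ≡ level x

    HasSibling : Fin n → Set
    HasSibling x = ∃ (Sibling x)

    Child : Fin n → Fin n → Set
    Child x y = x ~ y × level y ≡ suc (level x)

    child? : ∀ x y → Dec (Child x y)
    child? x y = (adj G x y ≟ᵇ true) ×-dec (level y ≟ℕ suc (level x))

    sibling? : ∀ x s → Dec (Sibling x s)
    sibling? x s = (adj G x s ≟ᵇ true) ×-dec (level s ≟ℕ level x)

    has-sibling? : ∀ x → Dec (HasSibling x)
    has-sibling? x = any? (sibling? x)

    sibling : Fin n → Fin n
    sibling x = choice (sibling? x) x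

    sibling-spec : ∀ {x} → HasSibling x → Sibling x (sibling x)
    sibling-spec = choice-spec (sibling? _) _

    Sibling-sym : ∀ {x s} → Sibling x s → Sibling s x
    Sibling-sym (x~s , eq) = ~-sym x~s , sym eq

    sibling-≢root : ∀ {x s} → Sibling x s → x ≢ r
    sibling-≢root (x~s , eq) refl = ~-irrefl x~s (sym (level≡0 (trans eq level-root)))

    child-≢root : ∀ {x y} → Child x y → y ≢ r
    child-≢root (_ , eq) refl = 1+n≢0 (trans (sym eq) level-root)

    neighbour-cases : ∀ {x y} → x ~ y → suc (level y) ≡ level x ⊎ Sibling x y ⊎ Child x y
    neighbour-cases {x} {y} x~y with <-cmp (level y) (level x)
    ... | tri< y<x _ _ = inj₁ (≤-antisym y<x (level-adj x~y))
    ... | tri≈ _ y≡x _ = inj₂ (inj₁ (x~y , y≡x))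
    ... | tri> _ _ y>x = inj₂ (inj₂ (x~y , ≤-antisym (level-adj (~-sym x~y)) y>x))

    lower-≢root : ∀ {x y} → suc (level y) ≡ level x → x ≢ r
    lower-≢root eq refl = 1+n≢0 (trans eq level-root)

    private
      Lower : ℕ → Fin n → Fin n → Set
      Lower k a b = a ~ b × level b < k

      descent : ∀ k x → level x ≡ k → Star (Lower k) x r
      descent zero x eq rewrite level≡0 eq = ε
      descent (suc k) x eq with x ≟ r
      ... | yes refl = ε
      ... | no x≢r with parent-exists x≢r
      ...   | y , x~y , eqy =
        (x~y , ≤-reflexive (trans eqy eq))
        ◅ Star.map (λ (a~b , lt) → a~b , m<n⇒m<1+n lt) (descent k y (suc-injective (trans eqy eq)))

    External-sym : ∀ {B a b} → External B a b → External B b a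
    External-sym (a~b , not-both) = ~-sym a~b , λ (b∈ , a∈) → not-both (a∈ , b∈)

    descent-external : ∀ {B} x → (∀ z → z ∈ᵛ B → level x ≤ level z) → Star (External B) x r
    descent-external x below-B =
      Star.map (λ (a~b , lt) → a~b , λ (_ , b∈B) → <⇒≱ lt (below-B _ b∈B)) (descent (level x) x refl)

    external-path : ∀ {B u w} → (∀ z → z ∈ᵛ B → level u ≤ level z)
                  → (∀ z → z ∈ᵛ B → level w ≤ level z) → Star (External B) u w
    external-path {B} {u} {w} u-low w-low =
      descent-external {B} u u-low ◅◅ reverse (External-sym {B}) (descent-external {B} w w-low)

    record Shape (B : Subgraph G) : Set where
      field
        f : Fin 5 → Fin n
        f-injective : ∀ {i j} → f i ≡ f j → i ≡ j
        f∈B : ∀ i → f i ∈ᵛ B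
        f-onto : ∀ {v} → v ∈ᵛ B → ∃ λ i → f i ≡ v
        f-E : ∀ i j → E B (f i) (f j) ≡ C5adj i j
        level-f : ∀ i → level (f i) ≡ level (f zero) + height i

    module _ {B} (isB : IsBlock B) (f : Fin 5 → Fin n) (f-injective : ∀ {i j} → f i ≡ f j → i ≡ j)
             (f∈B : ∀ i → f i ∈ᵛ B) (f-onto : ∀ {v} → v ∈ᵛ B → ∃ λ i → f i ≡ v)
             (f-E : ∀ i j → E B (f i) (f j) ≡ C5adj i j) (top-low : ∀ j → level (f zero) ≤ level (f j)) where

      private
        t = level (f zero)

        top-lowest : ∀ z → z ∈ᵛ B → t ≤ level z
        top-lowest z z∈B with f-onto z∈B
        ... | j , refl = top-low j

        f~f : ∀ i j → C5adj i j ≡ true → f i ~ f j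
        f~f i j adj = E⊆adj B (f i) (f j) (trans (f-E i j) adj)

        -- The descents to r from two lowest vertices of B form an external path between them.
        top-unique : ∀ j → j ≢ zero → level (f j) ≢ t
        top-unique j j≢0 eq =
          no-external-path isB (f∈B zero) (f∈B j) (λ f0≡fj → j≢0 (sym (f-injective f0≡fj)))
            (external-path {B} top-lowest λ z z∈B → subst (_≤ level z) (sym eq) (top-lowest z z∈B))

        above-top : ∀ j → j ≢ zero → suc t ≤ level (f j)
        above-top j j≢0 = ≤∧≢⇒< (top-low j) λ eq → top-unique j j≢0 (sym eq)

        level-one : ∀ j → j ≢ zero → C5adj j zero ≡ true → level (f j) ≡ suc t
        level-one j j≢0 adj = ≤-antisym (level-adj (f~f j zero adj)) (above-top j j≢0)

        -- The parent of such an f j lies outside B and descends to r, as does the top.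
        not-level-one : ∀ j → j ≢ zero → C5adj j zero ≡ false → level (f j) ≢ suc t
        not-level-one j j≢0 non-adj eq with parent-exists fj≢r
          where
          fj≢r : f j ≢ r
          fj≢r fj≡r = 1+n≢0 (trans (sym eq) (trans (cong level fj≡r) level-root))
        ... | q , fj~q , eq-q =
          no-external-path isB (f∈B j) (f∈B zero) (λ fj≡f0 → j≢0 (f-injective fj≡f0))
            ((fj~q , λ (_ , q∈B) → q∉B q∈B) ◅ external-path {B} q-lowest top-lowest)
          where
          level-q : level q ≡ t
          level-q = suc-injective (trans eq-q eq)
          q-lowest : ∀ z → z ∈ᵛ B → level q ≤ level z
          q-lowest z z∈B = subst (_≤ level z) (sym level-q) (top-lowest z z∈B)
          q∉B : ¬ q ∈ᵛ B
          q∉B q∈B with f-onto q∈B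
          ... | k , refl with k ≟ zero
          ...   | no k≢0 = top-unique k k≢0 level-q
          ...   | yes refl = true≢false (trans (sym (trans (sym (f-E j zero)) fjEf0)) non-adj)
            where fjEf0 = block-induced isB (f∈B j) (f∈B zero) fj~q

        level-two : ∀ j m → j ≢ zero → C5adj j zero ≡ false → C5adj j m ≡ true → level (f m) ≡ suc t
                  → level (f j) ≡ suc (suc t)
        level-two j m j≢0 non-adj adj level-m =
          ≤-antisym (subst (λ k → level (f j) ≤ suc k) level-m (level-adj (f~f j m adj)))
                    (≤∧≢⇒< (above-top j j≢0) λ eq → not-level-one j j≢0 non-adj (sym eq))

      levels-from-top : ∀ i → level (f i) ≡ t + height i
      levels-from-top zero = sym (+-identityʳ t)
      levels-from-top (suc zero) = trans (level-one (# 1) (λ ()) refl) (+-comm 1 t)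
      levels-from-top (suc (suc (suc (suc zero)))) = trans (level-one (# 4) (λ ()) refl) (+-comm 1 t)
      levels-from-top (suc (suc zero)) =
        trans (level-two (# 2) (# 1) (λ ()) refl refl (level-one (# 1) (λ ()) refl)) (+-comm 2 t)
      levels-from-top (suc (suc (suc zero))) =
        trans (level-two (# 3) (# 4) (λ ()) refl refl (level-one (# 4) (λ ()) refl)) (+-comm 2 t)

    opaque
      shape : ∀ {B} → IsBlock B → IsoC5 B → Shape B
      shape {B} isB (f , f-injective , f∈B , f-onto , f-E) with argmin (level ∘ f)
      ... | i , lowest = record
        { f = f′ ; f-injective = f′-injective ; f∈B = f∈B ∘ rotate i ; f-onto = f′-onto
        ; f-E = λ a b → trans (f-E _ _) (C5adj-rotate i a b)
        ; level-f = levels-from-top isB f′ f′-injective (f∈B ∘ rotate i) f′-onto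
                      (λ a b → trans (f-E _ _) (C5adj-rotate i a b)) top-low }
        where
        f′ : Fin 5 → Fin n
        f′ = f ∘ rotate i
        f′-injective : ∀ {a b} → f′ a ≡ f′ b → a ≡ b
        f′-injective eq = rotate-injective i _ _ (f-injective eq)
        f′-onto : ∀ {v} → v ∈ᵛ B → ∃ λ a → f′ a ≡ v
        f′-onto v∈B with f-onto _ v∈B
        ... | k , fk≡v with rotate-surjective i k
        ...   | a , rot≡k = a , trans (cong f rot≡k) fk≡v
        top-low : ∀ j → level (f′ zero) ≤ level (f′ j)
        top-low j = subst (λ k → level (f k) ≤ level (f′ j)) (sym (rotate-zero i)) (lowest (rotate i j))

module Cactus {n} {G : Graph n} {r : Fin n} (levels : Levels.Levelling G r)
              (blocks-C5 : ∀ (B : Subgraph G) → IsBlock B → IsoC5 B) where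

  open Graphs G
  open Levels G
  open Tree levels

  record ShapedBlock : Set where
    field
      B : Subgraph G
      isB : IsBlock B
      block-shape : Shape B
    open Shape block-shape public

  module InBlock (sb : ShapedBlock) where

    open ShapedBlock sb

    private
      t = level (f zero)

    C5adj⇒~ : ∀ {i j} → C5adj i j ≡ true → f i ~ f j
    C5adj⇒~ {i} {j} adj = E⊆adj B (f i) (f j) (trans (f-E i j) adj)

    ~⇒C5adj : ∀ {i j} → f i ~ f j → C5adj i j ≡ true
    ~⇒C5adj {i} {j} fi~fj = trans (sym (f-E i j)) (block-induced isB (f∈B i) (f∈B j) fi~fj)

    heights-from-levels : ∀ k {a b} → k + level (f b) ≡ level (f a) → k + height b ≡ height a
    heights-from-levels k {a} {b} eq = +-cancelˡ-≡ t _ _ (begin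
      t + (k + height b)  ≡⟨ x∙yz≈y∙xz t k (height b) ⟩
      k + (t + height b)  ≡⟨ cong (k +_) (sym (level-f b)) ⟩
      k + level (f b)     ≡⟨ eq ⟩
      level (f a)         ≡⟨ level-f a ⟩
      t + height a        ∎)
      where open ≡-Reasoning

    levels-from-heights : ∀ k {a b} → k + height b ≡ height a → k + level (f b) ≡ level (f a)
    levels-from-heights k {a} {b} eq = begin
      k + level (f b)     ≡⟨ cong (k +_) (level-f b) ⟩
      k + (t + height b)  ≡⟨ x∙yz≈y∙xz k t (height b) ⟩
      t + (k + height b)  ≡⟨ cong (t +_) eq ⟩
      t + height a        ≡⟨ sym (level-f a) ⟩
      level (f a)         ∎
      where open ≡-Reasoning

    f≢root : ∀ {a} → a ≢ zero → f a ≢ r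
    f≢root {a} a≢0 fa≡r =
      a≢0 (height≡0⇒zero a (m+n≡0⇒n≡0 t (trans (sym (level-f a)) (trans (cong level fa≡r) level-root))))

    top-lowest : ∀ z → z ∈ᵛ B → t ≤ level z
    top-lowest z z∈B with f-onto z∈B
    ... | k , refl = subst (t ≤_) (sym (level-f k)) (m≤m+n t (height k))

    non-top : ∀ {a b x y} → f a ≡ x → f b ≡ y → x ~ y → level y ≤ level x → a ≢ zero
    non-top {b = b} refl refl fa~fb fb≤top refl = ~-irrefl fa~fb (cong f (sym b≡0))
      where
      b≡0 : b ≡ zero
      b≡0 = height≡0⇒zero b (heights-from-levels 0 (≤-antisym fb≤top (top-lowest (f b) (f∈B b))))

    lower-neighbour : ∀ {a y} → y ∈ᵛ B → f a ~ y → suc (level y) ≡ level (f a) → a ≢ zero × y ≡ f (below a)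
    lower-neighbour {a} y∈B fa~y eq with f-onto y∈B
    ... | b , refl = (λ { refl → 1+n≢0 heights }) , cong f (below-unique a b (~⇒C5adj fa~y) heights)
      where heights = heights-from-levels 1 eq

    level-neighbour : ∀ {a y} → y ∈ᵛ B → f a ~ y → level y ≡ level (f a) → height a ≡ 2 × y ≡ f (across a)
    level-neighbour {a} y∈B fa~y eq with f-onto y∈B
    ... | b , refl = level-edge-height a b (~⇒C5adj fa~y) heights , cong f (across-unique a b (~⇒C5adj fa~y) heights)
      where heights = heights-from-levels 0 eq

    sibling-at : ∀ {a} → height a ≡ 2 → Sibling (f a) (f (across a))
    sibling-at {a} h2 with C5adj-across a h2
    ... | adj , h2′ = C5adj⇒~ adj , levels-from-heights 0 (trans h2′ (sym h2))

    upper-neighbour : ∀ {a y} → a ≢ zero → y ∈ᵛ B → f a ~ y → level y ≡ suc (level (f a)) → y ≡ f (above a)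
    upper-neighbour {a} a≢0 y∈B fa~y eq with f-onto y∈B
    ... | b , refl = cong f (above-unique a b a≢0 (~⇒C5adj fa~y) (sym (heights-from-levels 1 (sym eq))))

  shaped : ∀ {B} → IsBlock B → ShapedBlock
  shaped {B} isB = record { B = B ; isB = isB ; block-shape = shape isB (blocks-C5 B isB) }

  InShapedBlock : Fin n → Fin n → Set
  InShapedBlock x y = ∃ λ sb → ∃₂ λ a b → ShapedBlock.f sb a ≡ x × ShapedBlock.f sb b ≡ y

  edge-in-shaped-block : ∀ {x y} → x ~ y → ¬ ¬ InShapedBlock x y
  edge-in-shaped-block {x} {y} x~y = ¬¬-map in-shape (edge-in-block x~y)
    where
    in-shape : (∃ λ B → IsBlock B × x ∈ᵛ B × y ∈ᵛ B) → InShapedBlock x y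
    in-shape (B , isB , x∈B , y∈B) with ShapedBlock.f-onto (shaped isB) x∈B | ShapedBlock.f-onto (shaped isB) y∈B
    ... | a , fa≡x | b , fb≡y = shaped isB , a , b , fa≡x , fb≡y

  record HomeBlock (x : Fin n) : Set where
    field
      block : ShapedBlock
      position : Fin 5
      position≢top : position ≢ zero
      at-position : ShapedBlock.f block position ≡ x
    open ShapedBlock block public
    open InBlock block public

  private
    -- Go round B′ from x down to its top, descend to r, and climb to the top of B.
    single-common-vertex-impossible : ∀ {x} (h h′ : HomeBlock x)
      → (∀ k → HomeBlock.f h′ k ≢ x → ¬ HomeBlock.f h′ k ∈ᵛ HomeBlock.B h)
      → level (HomeBlock.f h′ zero) ≤ level (HomeBlock.f h zero) → ⊥
    single-common-vertex-impossible {x} h h′ outside lower =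
      no-external-path H.isB x∈B (H.f∈B zero) x≢top (arc ◅◅ external-path {H.B} top′-lowest H.top-lowest)
      where
      module H = HomeBlock h
      module H′ = HomeBlock h′
      x∈B = subst (_∈ᵛ H.B) H.at-position (H.f∈B H.position)
      x≢top : x ≢ H.f zero
      x≢top x≡top = H.position≢top (H.f-injective (trans H.at-position x≡top))
      top′-lowest : ∀ z → z ∈ᵛ H.B → level (H′.f zero) ≤ level z
      top′-lowest z z∈B = ≤-trans lower (H.top-lowest z z∈B)
      edge-out : ∀ {i j} → C5adj i j ≡ true × height j < height H′.position → External H.B (H′.f i) (H′.f j)
      edge-out {j = j} (adj , lower-j) = H′.C5adj⇒~ adj , λ (_ , fj∈B) → outside j fj≢x fj∈B
        where fj≢x = λ fj≡x → <⇒≢ lower-j (cong height (H′.f-injective (trans fj≡x (sym H′.at-position))))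
      arc : Star (External H.B) x (H′.f zero)
      arc = subst (λ v → Star (External H.B) v (H′.f zero)) H′.at-position
                  (Star.gmap H′.f edge-out (C5-arc H′.position))

  home-unique : ∀ {x} (h h′ : HomeBlock x) → HomeBlock.B h′ ⊑ HomeBlock.B h
  home-unique {x} h h′ with any? (λ k → ¬? (H′.f k ≟ x) ×-dec (V H.B (H′.f k) ≟ᵇ true))
    where module H = HomeBlock h
          module H′ = HomeBlock h′
  ... | yes (k , fk≢x , fk∈B) =
    blocks-sharing-two-vertices H.isB H′.isB (λ x≡fk → fk≢x (sym x≡fk)) x∈B fk∈B x∈B′ (H′.f∈B k)
    where module H = HomeBlock h
          module H′ = HomeBlock h′
          x∈B = subst (_∈ᵛ H.B) H.at-position (H.f∈B H.position)
          x∈B′ = subst (_∈ᵛ H′.B) H′.at-position (H′.f∈B H′.position)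
  ... | no shares-only-x with level (H′.f zero) ≤? level (H.f zero)
    where module H = HomeBlock h
          module H′ = HomeBlock h′
  ...   | yes lower = ⊥-elim (single-common-vertex-impossible h h′ outside′ lower)
    where outside′ = λ k fk≢x fk∈B → shares-only-x (k , fk≢x , fk∈B)
  ...   | no higher = ⊥-elim (single-common-vertex-impossible h′ h outside (<⇒≤ (≰⇒> higher)))
    where
    module H = HomeBlock h
    module H′ = HomeBlock h′
    outside : ∀ k → H.f k ≢ x → ¬ H.f k ∈ᵛ H′.B
    outside k fk≢x fk∈B′ with H′.f-onto fk∈B′
    ... | k′ , f′k′≡fk = shares-only-x (k′ , (λ eq → fk≢x (trans (sym f′k′≡fk) eq))
                                        , subst (_∈ᵛ H.B) (sym f′k′≡fk) (H.f∈B k))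

  home-at : ∀ sb {a x} → a ≢ zero → ShapedBlock.f sb a ≡ x → HomeBlock x
  home-at sb a≢0 fa≡x = record { block = sb ; position = _ ; position≢top = a≢0 ; at-position = fa≡x }

  home-exists : ∀ {x} → x ≢ r → ¬ ¬ HomeBlock x
  home-exists {x} x≢r = ¬¬-map home (edge-in-shaped-block x~p)
    where
    x~p = proj₁ (parent-spec x≢r)
    p≤x = ≤-trans (n≤1+n _) (≤-reflexive (proj₂ (parent-spec x≢r)))
    home : InShapedBlock x (parent x) → HomeBlock x
    home (sb , a , b , fa≡x , fb≡p) = record
      { block = sb ; position = a ; at-position = fa≡x
      ; position≢top = InBlock.non-top sb fa≡x fb≡p x~p p≤x }

  low-neighbour-at-home : ∀ {x y} (h : HomeBlock x) → x ~ y → level y ≤ level x → y ∈ᵛ HomeBlock.B h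
  low-neighbour-at-home {x} {y} h x~y y≤x =
    decidable-stable (V (HomeBlock.B h) y ≟ᵇ true) (¬¬-map at-home (edge-in-shaped-block x~y))
    where
    at-home : InShapedBlock x y → y ∈ᵛ HomeBlock.B h
    at-home (sb , a , b , fa≡x , fb≡y) =
      proj₁ (home-unique h h′) y (subst (_∈ᵛ ShapedBlock.B sb) fb≡y (ShapedBlock.f∈B sb b))
      where
      h′ : HomeBlock x
      h′ = record { block = sb ; position = a ; at-position = fa≡x
                  ; position≢top = InBlock.non-top sb fa≡x fb≡y x~y y≤x }

  module AtHome {x} (h : HomeBlock x) where

    open HomeBlock h

    private
      fp~ : ∀ {y} → x ~ y → f position ~ y
      fp~ {y} x~y = subst (_~ y) (sym at-position) x~y

      level-fp : ∀ {k} → k ≡ level x → k ≡ level (f position)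
      level-fp eq = trans eq (cong level (sym at-position))

    lower-at-home : ∀ {y} → x ~ y → suc (level y) ≡ level x → y ≡ f (below position)
    lower-at-home x~y eq =
      proj₂ (lower-neighbour (low-neighbour-at-home h x~y (≤-trans (n≤1+n _) (≤-reflexive eq))) (fp~ x~y) (level-fp eq))

    same-level-at-home : ∀ {y} → x ~ y → level y ≡ level x → height position ≡ 2 × y ≡ f (across position)
    same-level-at-home x~y eq = level-neighbour (low-neighbour-at-home h x~y (≤-reflexive eq)) (fp~ x~y) (level-fp eq)

    parent-at-home : parent x ≡ f (below position)
    parent-at-home = lower-at-home (proj₁ parent-x) (proj₂ parent-x)
      where parent-x = parent-spec (λ x≡r → f≢root position≢top (trans at-position x≡r))

  open AtHome

  parent-at : ∀ sb {a} → a ≢ zero → parent (ShapedBlock.f sb a) ≡ ShapedBlock.f sb (below a)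
  parent-at sb a≢0 = parent-at-home (home-at sb a≢0 refl)

  grandparent-at : ∀ sb {a} → height a ≡ 2 → parent (parent (ShapedBlock.f sb a)) ≡ ShapedBlock.f sb zero
  grandparent-at sb {a} h2 = begin
    parent (parent (f a))   ≡⟨ cong parent (parent-at sb (height≡2⇒≢zero a h2)) ⟩
    parent (f (below a))    ≡⟨ parent-at sb (below-≢zero a h2) ⟩
    f (below (below a))     ≡⟨ cong f (below-below a h2) ⟩
    f zero                  ∎
    where open ≡-Reasoning
          open ShapedBlock sb

  parent-unique : ∀ {x y y′} → x ~ y → x ~ y′ → suc (level y) ≡ level x → suc (level y′) ≡ level x
                → y ≡ y′
  parent-unique {x} {y} {y′} x~y x~y′ eq eq′ =
    decidable-stable (y ≟ y′) (¬¬-map (λ h → trans (lower-at-home h x~y eq) (sym (lower-at-home h x~y′ eq′)))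
                                      (home-exists (lower-≢root eq)))

  sibling-unique : ∀ {x s s′} → Sibling x s → Sibling x s′ → s ≡ s′
  sibling-unique {x} {s} {s′} (x~s , eq) (x~s′ , eq′) =
    decidable-stable (s ≟ s′) (¬¬-map same (home-exists (sibling-≢root (x~s , eq))))
    where
    same : HomeBlock x → s ≡ s′
    same h = trans (proj₂ (same-level-at-home h x~s eq)) (sym (proj₂ (same-level-at-home h x~s′ eq′)))

  SiblingHome : Fin n → Fin n → Set
  SiblingHome x s = ∃ λ (h : HomeBlock x) → let open HomeBlock h in height position ≡ 2 × s ≡ f (across position)

  sibling-home : ∀ {x s} → Sibling x s → ¬ ¬ SiblingHome x s
  sibling-home {x} sib@(x~s , eq) = ¬¬-map (λ h → h , same-level-at-home h x~s eq) (home-exists (sibling-≢root sib))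

  module _ {x s} (sib : Sibling x s) where

    grandparent-sibling : parent (parent x) ≡ parent (parent s)
    grandparent-sibling = decidable-stable (_ ≟ _) (¬¬-map same-top (sibling-home sib))
      where
      same-top : SiblingHome x s → parent (parent x) ≡ parent (parent s)
      same-top (h , h2 , s≡) = begin
        parent (parent x)                 ≡⟨ cong (parent ∘ parent) (sym at-position) ⟩
        parent (parent (f position))      ≡⟨ grandparent-at block h2 ⟩
        f zero                            ≡⟨ sym (grandparent-at block (proj₂ (C5adj-across position h2))) ⟩
        parent (parent (f (across position))) ≡⟨ cong (parent ∘ parent) (sym s≡) ⟩
        parent (parent s)                 ∎
        where open ≡-Reasoning
              open HomeBlock h

    parent-of-sibling : ∀ (sh : SiblingHome x s) → let open HomeBlock (proj₁ sh) in parent x ≡ f (below position)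
    parent-of-sibling (h , _) = parent-at-home h

    sibling-parent-no-sibling : ¬ HasSibling (parent x)
    sibling-parent-no-sibling (z , p~z , eq) = sibling-home sib λ sh@(h , h2 , _) →
      let open HomeBlock h
          p≡ = parent-of-sibling sh
          hp = home-at block (below-≢zero position h2) refl
      in height-below≢2 position h2
           (proj₁ (same-level-at-home hp (subst (_~ z) p≡ p~z) (trans eq (cong level p≡))))

    sibling-parent-≢root : parent x ≢ r
    sibling-parent-≢root p≡r = sibling-home sib λ sh@(h , h2 , _) →
      let open HomeBlock h in
      f≢root (below-≢zero position h2) (trans (sym (parent-of-sibling sh)) p≡r)

    sibling-parents-differ : parent x ≢ parent s
    sibling-parents-differ p≡p′ = sibling-home sib λ sh@(h , h2 , s≡) →
      let open HomeBlock h
          parent-s = trans (cong parent s≡) (parent-at block (height≡2⇒≢zero _ (proj₂ (C5adj-across position h2))))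
      in below-across position h2 (f-injective (trans (sym (parent-of-sibling sh)) (trans p≡p′ parent-s)))

  child-with-sibling : ∀ {c} → c ≢ r → ¬ HasSibling c → ¬ ¬ (∃ λ m → Child c m × HasSibling m)
  child-with-sibling {c} c≢r lonely = ¬¬-map upward (home-exists c≢r)
    where
    upward : HomeBlock c → ∃ λ m → Child c m × HasSibling m
    upward h = by-height (height position ≟ℕ 2)
      where
      open HomeBlock h
      by-height : Dec (height position ≡ 2) → ∃ λ m → Child c m × HasSibling m
      by-height (yes h2) = ⊥-elim (lonely (_ , subst (λ v → Sibling v (f (across position))) at-position (sibling-at h2)))
      by-height (no h≢2) with C5adj-above position position≢top h≢2
      ... | adj , up , h2 =
        f (above position) , subst (λ v → Child v (f (above position))) at-position
                                   (C5adj⇒~ adj , sym (levels-from-heights 1 (sym up)))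
        , _ , sibling-at h2

  child-with-sibling-unique : ∀ {c m m′} → Child c m → HasSibling m → Child c m′ → HasSibling m′ → m ≡ m′
  child-with-sibling-unique {c} {m} {m′} c→m (_ , m∼s) c→m′ (_ , m′∼s′) =
    decidable-stable (m ≟ m′) λ m≢m′ → sibling-home m∼s λ (h , h2 , _) → sibling-home m′∼s′ λ (h′ , h2′ , _) →
      m≢m′ (same-upper h h2 h′ h2′)
    where
    below-child : ∀ {x} (h : HomeBlock x) → Child c x → c ≡ HomeBlock.f h (below (HomeBlock.position h))
    below-child h (c~x , eq) = lower-at-home h (~-sym c~x) (sym eq)

    home-of-c : ∀ {x} (h : HomeBlock x) → height (HomeBlock.position h) ≡ 2 → Child c x → HomeBlock c
    home-of-c h h2 c→x = home-at (HomeBlock.block h) (below-≢zero _ h2) (sym (below-child h c→x))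

    same-upper : (h : HomeBlock m) → height (HomeBlock.position h) ≡ 2
               → (h′ : HomeBlock m′) → height (HomeBlock.position h′) ≡ 2 → m ≡ m′
    same-upper h h2 h′ h2′ = begin
      m                          ≡⟨ sym at-position ⟩
      f position                 ≡⟨ cong f (sym (above-below position h2)) ⟩
      f (above (below position)) ≡⟨ sym (upper-neighbour (below-≢zero position h2) m′∈B c~m′ level-m′) ⟩
      m′                         ∎
      where
      open ≡-Reasoning
      open HomeBlock h
      c≡ = below-child h c→m
      m′∈B = proj₁ (home-unique (home-of-c h h2 c→m) (home-of-c h′ h2′ c→m′)) m′
                   (subst (_∈ᵛ HomeBlock.B h′) (HomeBlock.at-position h′) (HomeBlock.f∈B h′ _))
      c~m′ = subst (_~ m′) c≡ (proj₁ c→m′)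
      level-m′ = trans (proj₂ c→m′) (cong (suc ∘ level) c≡)

  parent-of-child : ∀ {u w} → Child u w → parent w ≡ u
  parent-of-child {u} {w} (u~w , eq) =
    parent-unique (proj₁ parent-w) (~-sym u~w) (proj₂ parent-w) (sym eq)
    where parent-w = parent-spec (child-≢root (u~w , eq))

  upper : Fin n → Fin n
  upper c = choice (λ m → child? c m ×-dec has-sibling? m) c

  module _ {c} (c≢r : c ≢ r) (lonely : ¬ HasSibling c) where

    upper-spec : Child c (upper c) × HasSibling (upper c)
    upper-spec = choice-spec _ _ (decidable-stable (any? λ m → child? c m ×-dec has-sibling? m)
                                                   (child-with-sibling c≢r lonely))

    upper-unique : ∀ {m} → Child c m → HasSibling m → m ≡ upper c
    upper-unique child has = child-with-sibling-unique child has (proj₁ upper-spec) (proj₂ upper-spec)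

  -- In the block with top g containing a lonely c ≠ r, the path c → upper c → its sibling → parent
  -- ends at the other neighbour of g.
  partner : Fin n → Fin n
  partner c = parent (sibling (upper c))

  module _ {c} (c≢r : c ≢ r) (lonely : ¬ HasSibling c) where

    private
      m = upper c
      s = sibling m
      c→m = proj₁ (upper-spec c≢r lonely)
      m∼s : Sibling m s
      m∼s = sibling-spec (proj₂ (upper-spec c≢r lonely))
      s∼m = Sibling-sym m∼s
      s≢r = sibling-≢root s∼m
      s→partner = parent-spec s≢r
      parent-m : parent m ≡ c
      parent-m = parent-of-child c→m

    partner-parent : parent (partner c) ≡ parent c
    partner-parent = sym (trans (cong parent (sym parent-m)) (grandparent-sibling m∼s))

    partner-lonely : ¬ HasSibling (partner c)
    partner-lonely = sibling-parent-no-sibling s∼m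

    partner-≢root : partner c ≢ r
    partner-≢root = sibling-parent-≢root s∼m

    partner-≢ : partner c ≢ c
    partner-≢ eq = sibling-parents-differ m∼s (trans parent-m (sym eq))

    partner-level : level (partner c) ≡ level c
    partner-level = suc-injective (trans (proj₂ s→partner) (trans (proj₂ m∼s) (proj₂ c→m)))

    partner-child : Child (parent c) (partner c)
    partner-child = subst (λ g → Child g (partner c)) partner-parent
                          (~-sym (proj₁ (parent-spec partner-≢root)) , sym (proj₂ (parent-spec partner-≢root)))

    upper-partner : upper (partner c) ≡ s
    upper-partner = sym (upper-unique partner-≢root partner-lonely
                                      (~-sym (proj₁ s→partner) , sym (proj₂ s→partner)) (m , s∼m))

    partner-involutive : partner (partner c) ≡ c
    partner-involutive = begin
      parent (sibling (upper (partner c)))  ≡⟨ cong (parent ∘ sibling) upper-partner ⟩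
      parent (sibling s)                    ≡⟨ cong parent (sibling-unique (sibling-spec (m , s∼m)) s∼m) ⟩
      parent m                              ≡⟨ parent-m ⟩
      c                                     ∎
      where open ≡-Reasoning

module Colouring {n} {G : Graph n} {r : Fin n} (levels : Levels.Levelling G r)
                 (blocks-C5 : ∀ (B : Subgraph G) → IsBlock B → IsoC5 B) where

  open Graphs G
  open Levels G
  open Tree levels
  open Cactus levels blocks-C5

  HasSmallerSibling : Fin n → Set
  HasSmallerSibling x = ∃ λ s → Sibling x s × toℕ s < toℕ x

  colour-step : Fin n → Fin 4 → Fin 4
  colour-step x c with any? (λ s → sibling? x s ×-dec toℕ s <? toℕ x)
  ... | yes _ = succ (succ c)
  ... | no _ = succ c

  colour-step-cases : ∀ x c → colour-step x c ≡ succ c ⊎ colour-step x c ≡ succ (succ c)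
  colour-step-cases x c with any? (λ s → sibling? x s ×-dec toℕ s <? toℕ x)
  ... | yes _ = inj₂ refl
  ... | no _ = inj₁ refl

  colour-step-smaller : ∀ {x} c → HasSmallerSibling x → colour-step x c ≡ succ (succ c)
  colour-step-smaller {x} c smaller with any? (λ s → sibling? x s ×-dec toℕ s <? toℕ x)
  ... | yes _ = refl
  ... | no none = ⊥-elim (none smaller)

  colour-step-not-smaller : ∀ {x} c → ¬ HasSmallerSibling x → colour-step x c ≡ succ c
  colour-step-not-smaller {x} c not-smaller with any? (λ s → sibling? x s ×-dec toℕ s <? toℕ x)
  ... | yes smaller = ⊥-elim (not-smaller smaller)
  ... | no _ = refl

  colour-step-lonely : ∀ {x} c → ¬ HasSibling x → colour-step x c ≡ succ c
  colour-step-lonely c lonely = colour-step-not-smaller c λ (s , sib , _) → lonely (s , sib)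

  colour-step-≢ : ∀ x c → colour-step x c ≢ c
  colour-step-≢ x c = [ (λ eq → succ-≢ c ∘ trans (sym eq)) , (λ eq → succ²-≢ c ∘ trans (sym eq)) ]′
                      (colour-step-cases x c)

  no-smaller-sibling : ∀ {x s} → Sibling x s → toℕ x < toℕ s → ¬ HasSmallerSibling x
  no-smaller-sibling sib x<s (s′ , sib′ , s′<x) rewrite sibling-unique sib′ sib = <-asym x<s s′<x

  colour-step-siblings : ∀ {x s} c → Sibling x s → colour-step x c ≢ colour-step s c
  colour-step-siblings {x} {s} c sib with <-cmp (toℕ x) (toℕ s)
  ... | tri< x<s _ _ rewrite colour-step-not-smaller c (no-smaller-sibling sib x<s)
                           | colour-step-smaller c (x , Sibling-sym sib , x<s) = succ-≢-succ² c
  ... | tri≈ _ x≡s _ = ⊥-elim (~-irrefl (proj₁ sib) (toℕ-injective x≡s))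
  ... | tri> _ _ s<x rewrite colour-step-smaller c (s , sib , s<x)
                           | colour-step-not-smaller c (no-smaller-sibling (Sibling-sym sib) s<x) =
    succ-≢-succ² c ∘ sym

  two-steps-≢ : ∀ {u y} c → ¬ (HasSibling u × HasSibling y) → colour-step y (colour-step u c) ≢ c
  two-steps-≢ {u} {y} c not-both = by-cases (has-sibling? u)
    where
    by-cases : Dec (HasSibling u) → colour-step y (colour-step u c) ≢ c
    by-cases (no lonely-u) rewrite colour-step-lonely c lonely-u =
      [ (λ eq → succ²-≢ c ∘ trans (sym eq)) , (λ eq → succ³-≢ c ∘ trans (sym eq)) ]′
      (colour-step-cases y (succ c))
    by-cases (yes has-u) rewrite colour-step-lonely (colour-step u c) (λ has-y → not-both (has-u , has-y)) =
      [ (λ eq → succ²-≢ c ∘ trans (cong succ (sym eq))) , (λ eq → succ³-≢ c ∘ trans (cong succ (sym eq))) ]′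
      (colour-step-cases u c)

  colour-at : ℕ → Fin n → Fin 4
  colour-at zero _ = zero
  colour-at (suc k) x = colour-step x (colour-at k (parent x))

  φ : Coloring n 4
  φ x = colour-at (level x) x

  φ-root : φ r ≡ zero
  φ-root = cong (λ k → colour-at k r) level-root

  φ-step : ∀ {x} → x ≢ r → φ x ≡ colour-step x (φ (parent x))
  φ-step {x} x≢r = cong (λ k → colour-at k x) (sym (proj₂ (parent-spec x≢r)))

  φ-child : ∀ {u w} → Child u w → φ w ≡ colour-step w (φ u)
  φ-child {w = w} child = trans (φ-step (child-≢root child)) (cong (colour-step w ∘ φ) (parent-of-child child))

  φ-parent-of-sibling : ∀ {x s} → Sibling x s → φ (parent x) ≡ succ (φ (parent (parent x)))
  φ-parent-of-sibling sib =
    trans (φ-step (sibling-parent-≢root sib)) (colour-step-lonely _ (sibling-parent-no-sibling sib))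

  φ-parents-of-siblings : ∀ {x s} → Sibling x s → φ (parent x) ≡ φ (parent s)
  φ-parents-of-siblings sib =
    trans (φ-parent-of-sibling sib)
          (trans (cong (succ ∘ φ) (grandparent-sibling sib)) (sym (φ-parent-of-sibling (Sibling-sym sib))))

  φ-sibling : ∀ {x s} → Sibling x s → φ s ≡ colour-step s (φ (parent x))
  φ-sibling {s = s} sib =
    trans (φ-step (sibling-≢root (Sibling-sym sib))) (cong (colour-step s) (sym (φ-parents-of-siblings sib)))

  φ-proper : Proper G φ
  φ-proper u w u~w with neighbour-cases u~w
  ... | inj₁ lower = λ eq → colour-step-≢ u (φ w) (trans (sym (φ-child (~-sym u~w , sym lower))) eq)
  ... | inj₂ (inj₂ child) = λ eq → colour-step-≢ w (φ u) (trans (sym (φ-child child)) (sym eq))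
  ... | inj₂ (inj₁ sib) = λ eq → colour-step-siblings (φ (parent u)) sib
    (trans (sym (φ-step (sibling-≢root sib))) (trans eq (φ-sibling sib)))

  parent-colour-once : ∀ {u y} → u ≢ r → u ~ y → φ y ≡ φ (parent u) → y ≡ parent u
  parent-colour-once {u} {y} u≢r u~y eq with neighbour-cases u~y
  ... | inj₁ lower = parent-unique u~y (proj₁ (parent-spec u≢r)) lower (proj₂ (parent-spec u≢r))
  ... | inj₂ (inj₁ sib) = ⊥-elim (colour-step-≢ y _ (trans (sym (φ-sibling sib)) eq))
  ... | inj₂ (inj₂ child) = ⊥-elim (two-steps-≢ (φ (parent u)) not-both
    (trans (sym (trans (φ-child child) (cong (colour-step y) (φ-step u≢r)))) eq))
    where
    not-both : ¬ (HasSibling u × HasSibling y)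
    not-both (has-u , (_ , sib-y)) = sibling-parent-no-sibling sib-y (subst HasSibling (sym (parent-of-child child)) has-u)

  φ-odd : ∀ {u} → u ≢ r → OddCond G φ u
  φ-odd {u} u≢r = φ (parent u) , λ even → odd-1 (subst Even once even)
    where
    once : nbrCount G φ u (φ (parent u)) ≡ 1
    once = trans (nbrCount≡count φ u (φ (parent u)))
                 (count-unique (∧-true⁺ (proj₁ (parent-spec u≢r)) (≟-refl (φ (parent u))))
                               λ y uy → parent-colour-once u≢r (proj₁ (∧-true⁻ (adj G u y) uy))
                                                             (≟-true⁻ (proj₂ (∧-true⁻ (adj G u y) uy))))

  φ-even-root : EvenCond G φ r
  φ-even-root = # 2 , (λ 2≡φr → two≢zero (trans 2≡φr φ-root)) , subst Even (sym none) (2 ∣0)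
    where
    two≢zero : # 2 ≢ zero
    two≢zero ()
    neighbour-colour : ∀ {y} → r ~ y → φ y ≡ # 1
    neighbour-colour r~y with neighbour-cases r~y
    ... | inj₁ lower = ⊥-elim (lower-≢root lower refl)
    ... | inj₂ (inj₁ sib) = ⊥-elim (sibling-≢root sib refl)
    ... | inj₂ (inj₂ child) = trans (φ-child child) (trans (colour-step-lonely (φ r) lonely) (cong succ φ-root))
      where lonely = λ (_ , sib) → sibling-parent-≢root sib (parent-of-child child)
    none : nbrCount G φ r (# 2) ≡ 0
    none = trans (nbrCount≡count φ r (# 2)) (count-none λ y → ≢true⇒false λ ry →
      let r~y , φy≡2 = ∧-true⁻ (adj G r y) ry in one≢two (trans (sym (neighbour-colour r~y)) (≟-true⁻ φy≡2)))
      where one≢two : # 1 ≢ # 2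
            one≢two ()

module NeighbourhoodParity {n} (G : Graph n) {k} (ψ : Coloring n k) where

  open Graphs G

  ColourPairing : Fin n → (Fin n → Fin n) → Set
  ColourPairing x π = ∀ y → x ~ y → x ~ π y × π (π y) ≡ y × π y ≢ y × ψ (π y) ≡ ψ y

  paired⇒¬odd : ∀ {x π} → ColourPairing x π → ¬ OddCond G ψ x
  paired⇒¬odd {x} {π} pairing (i , odd) = odd (subst Even (sym (nbrCount≡count ψ x i)) (even-count paired))
    where
    paired : PairedBy (λ y → adj G x y ∧ ⌊ ψ y ≟ i ⌋) π
    paired y xy with ∧-true⁻ (adj G x y) xy
    ... | x~y , ψy≡i with pairing y x~y
    ...   | x~πy , ππy≡y , πy≢y , ψπy≡ψy =
      ∧-true⁺ x~πy (≟-true⁺ (trans ψπy≡ψy (≟-true⁻ ψy≡i))) , ππy≡y , πy≢y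

  paired-but-two⇒¬odd : ∀ {x a b π} → a ≢ b → x ~ a → x ~ b → ψ a ≡ ψ b
    → (∀ y → x ~ y → y ≢ a → y ≢ b
         → x ~ π y × π y ≢ a × π y ≢ b × π (π y) ≡ y × π y ≢ y × ψ (π y) ≡ ψ y)
    → ¬ OddCond G ψ x
  paired-but-two⇒¬odd {x} {a} {b} {π} a≢b x~a x~b ψa≡ψb pairing = paired⇒¬odd swapped
    where
    σ = swap a b π
    swapped : ColourPairing x σ
    swapped y x~y = by-cases (y ≟ a) (y ≟ b)
      where
      by-cases : Dec (y ≡ a) → Dec (y ≡ b) → x ~ σ y × σ (σ y) ≡ y × σ y ≢ y × ψ (σ y) ≡ ψ y
      by-cases (yes refl) _ rewrite swap-a y b π | swap-b {a = y} π a≢b =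
        x~b , refl , (λ b≡y → a≢b (sym b≡y)) , sym ψa≡ψb
      by-cases (no _) (yes refl) rewrite swap-b {a = a} π a≢b | swap-a a y π = x~a , refl , a≢b , ψa≡ψb
      by-cases (no y≢a) (no y≢b) with pairing y x~y y≢a y≢b
      ... | x~πy , πy≢a , πy≢b , ππy≡y , πy≢y , ψπy≡ψy
        rewrite swap-other π y≢a y≢b | swap-other π πy≢a πy≢b = x~πy , ππy≡y , πy≢y , ψπy≡ψy

module NoOddColouring {n} {G : Graph n} {r : Fin n} (levels : Levels.Levelling G r)
                      (blocks-C5 : ∀ (B : Subgraph G) → IsBlock B → IsoC5 B)
                      (ψ : Coloring n 4) (ψ-proper : Proper G ψ)
                      (ψ-odd : ∀ x → NonIsolated G x → OddCond G ψ x) where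

  open Graphs G
  open Levels G
  open Tree levels
  open Cactus levels blocks-C5
  open NeighbourhoodParity G ψ

  LonelyChild : Fin n → Fin n → Set
  LonelyChild x y = Child x y × ¬ HasSibling y

  PartnersAgree : Fin n → Set
  PartnersAgree g = ∀ c → LonelyChild g c → ψ c ≡ ψ (partner c)

  partner-of-lonely-child : ∀ {x y} → LonelyChild x y → LonelyChild x (partner y)
  partner-of-lonely-child {x} (child , lonely) =
    subst (λ g → LonelyChild g _) (parent-of-child child) (partner-child y≢r lonely , partner-lonely y≢r lonely)
    where y≢r = child-≢root child

  -- The other neighbours of x pair off by partner with equal colours, so ψ a ≡ ψ b would make every
  -- colour class in the neighbourhood of x even.
  exceptional-neighbours-differ : ∀ {x a b} → PartnersAgree x → x ~ a → x ~ b → a ≢ b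
    → ¬ LonelyChild x a → ¬ LonelyChild x b
    → (∀ y → x ~ y → y ≢ a → y ≢ b → LonelyChild x y)
    → ψ a ≢ ψ b
  exceptional-neighbours-differ {x} {a} {b} agree x~a x~b a≢b a-special b-special others ψa≡ψb =
    paired-but-two⇒¬odd a≢b x~a x~b ψa≡ψb pairing (ψ-odd x (a , x~a))
    where
    pairing : ∀ y → x ~ y → y ≢ a → y ≢ b → x ~ partner y × partner y ≢ a × partner y ≢ b
                × partner (partner y) ≡ y × partner y ≢ y × ψ (partner y) ≡ ψ y
    pairing y x~y y≢a y≢b =
      proj₁ (proj₁ lonely′) , (λ { refl → a-special lonely′ }) , (λ { refl → b-special lonely′ })
      , partner-involutive y≢r (proj₂ lonely) , partner-≢ y≢r (proj₂ lonely) , sym (agree y lonely)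
      where
      lonely = others y x~y y≢a y≢b
      lonely′ = partner-of-lonely-child lonely
      y≢r = child-≢root (proj₁ lonely)

  private
    below-≢-above : ∀ {x a b} → suc (level a) ≡ level x → level b ≡ suc (level x) → a ≢ b
    below-≢-above lower upper a≡b =
      <⇒≢ (<-trans (≤-reflexive lower) (≤-reflexive (sym upper))) (cong level a≡b)

    below-≢-level : ∀ {x a b} → suc (level a) ≡ level x → level b ≡ level x → a ≢ b
    below-≢-level lower same a≡b = <⇒≢ (≤-reflexive (trans lower (sym same))) (cong level a≡b)

  parent-upper-differ : ∀ {c} → c ≢ r → ¬ HasSibling c → PartnersAgree c → ψ (parent c) ≢ ψ (upper c)
  parent-upper-differ {c} c≢r lonely agree =
    exceptional-neighbours-differ agree c~p c~m (below-≢-above p-lower (proj₂ c→m))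
      (λ (child , _) → below-≢-above p-lower (proj₂ child) refl) (λ (_ , no-sibling) → no-sibling has-m) others
    where
    c~p = proj₁ (parent-spec c≢r)
    p-lower = proj₂ (parent-spec c≢r)
    c→m = proj₁ (upper-spec c≢r lonely)
    c~m = proj₁ c→m
    has-m = proj₂ (upper-spec c≢r lonely)
    others : ∀ y → c ~ y → y ≢ parent c → y ≢ upper c → LonelyChild c y
    others y c~y y≢p y≢m with neighbour-cases c~y
    ... | inj₁ lower = ⊥-elim (y≢p (parent-unique c~y c~p lower p-lower))
    ... | inj₂ (inj₁ sib) = ⊥-elim (lonely (y , sib))
    ... | inj₂ (inj₂ child) = child , λ has-y → y≢m (upper-unique c≢r lonely child has-y)

  parent-sibling-differ : ∀ {x s} → Sibling x s → PartnersAgree x → ψ (parent x) ≢ ψ s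
  parent-sibling-differ {x} {s} sib agree =
    exceptional-neighbours-differ agree x~p (proj₁ sib) (below-≢-level p-lower (proj₂ sib))
      (λ (child , _) → below-≢-above p-lower (proj₂ child) refl)
      (λ (child , _) → <-irrefl (trans (sym (proj₂ sib)) (proj₂ child)) (n<1+n _)) others
    where
    x≢r = sibling-≢root sib
    x~p = proj₁ (parent-spec x≢r)
    p-lower = proj₂ (parent-spec x≢r)
    others : ∀ y → x ~ y → y ≢ parent x → y ≢ s → LonelyChild x y
    others y x~y y≢p y≢s with neighbour-cases x~y
    ... | inj₁ lower = ⊥-elim (y≢p (parent-unique x~y x~p lower p-lower))
    ... | inj₂ (inj₁ sib′) = ⊥-elim (y≢s (sibling-unique sib′ sib))
    ... | inj₂ (inj₂ child) = child , λ (_ , sib-y) →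
      sibling-parent-no-sibling sib-y (subst HasSibling (sym (parent-of-child child)) (s , sib))

  -- In the block g c m s c′ the odd condition at c, m, s and c′ gives ψ g ≢ ψ m, ψ c ≢ ψ s,
  -- ψ c′ ≢ ψ m and ψ g ≢ ψ s; with the five cycle edges, four colours force ψ c′ ≡ ψ c.
  partners-agree-step : ∀ g → (∀ w → suc (level g) ≤ level w → PartnersAgree w) → PartnersAgree g
  partners-agree-step g agree-above c (child , lonely) =
    sym (four-colours (ψ g) (ψ c) (ψ m) (ψ s) (ψ c′) g≢c g≢m g≢s c≢m c≢s m≢s c′≢g c′≢m c′≢s)
    where
    c≢r = child-≢root child
    m = upper c
    c→m = proj₁ (upper-spec c≢r lonely)
    m∼s = sibling-spec (proj₂ (upper-spec c≢r lonely))
    s = sibling m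
    c′ = partner c
    s≢r = sibling-≢root (Sibling-sym m∼s)
    level-c = ≤-reflexive (sym (proj₂ child))
    level-m = ≤-trans level-c (≤-trans (n≤1+n _) (≤-reflexive (sym (proj₂ c→m))))
    parent-c′ = trans (partner-parent c≢r lonely) (parent-of-child child)
    g≢c = ψ-proper g c (proj₁ child)
    g≢m = subst (λ v → ψ v ≢ ψ m) (parent-of-child child) (parent-upper-differ c≢r lonely (agree-above c level-c))
    g≢s = subst₂ (λ u v → ψ u ≢ ψ v) parent-c′ (upper-partner c≢r lonely)
            (parent-upper-differ (partner-≢root c≢r lonely) (partner-lonely c≢r lonely)
              (agree-above c′ (≤-trans level-c (≤-reflexive (sym (partner-level c≢r lonely))))))
    c≢m = ψ-proper c m (proj₁ c→m)
    c≢s = subst (λ v → ψ v ≢ ψ s) (parent-of-child c→m) (parent-sibling-differ m∼s (agree-above m level-m))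
    m≢s = ψ-proper m s (proj₁ m∼s)
    c′≢g = λ eq → ψ-proper g c′ (subst (_~ c′) (parent-of-child child) (proj₁ (partner-child c≢r lonely)))
                               (sym eq)
    c′≢m = parent-sibling-differ (Sibling-sym m∼s) (agree-above s (≤-trans level-m (≤-reflexive (sym (proj₂ m∼s)))))
    c′≢s = λ eq → ψ-proper s c′ (proj₁ (parent-spec s≢r)) (sym eq)

  partners-agree-above : ∀ k g → ∑ level ≤ level g + k → PartnersAgree g
  partners-agree-above zero g bound c (child , _) =
    ⊥-elim (<-irrefl refl (≤-trans (≤-reflexive (sym (proj₂ child)))
                                   (≤-trans (≤-∑ level c) (≤-trans bound (≤-reflexive (+-identityʳ _))))))
  partners-agree-above (suc k) g bound = partners-agree-step g λ w above →
    partners-agree-above k w (≤-trans bound (≤-trans (≤-reflexive (+-suc (level g) k)) (+-monoˡ-≤ k above)))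

  partners-agree : ∀ g → PartnersAgree g
  partners-agree g = partners-agree-above (∑ level) g (m≤n+m _ _)

  root-neighbour-lonely : ∀ {y} → r ~ y → LonelyChild r y
  root-neighbour-lonely r~y with neighbour-cases r~y
  ... | inj₁ lower = ⊥-elim (lower-≢root lower refl)
  ... | inj₂ (inj₁ sib) = ⊥-elim (sibling-≢root sib refl)
  ... | inj₂ (inj₂ child) = child , λ (_ , sib) → sibling-parent-≢root sib (parent-of-child child)

  root-not-odd : ¬ OddCond G ψ r
  root-not-odd = paired⇒¬odd pairing
    where
    pairing : ColourPairing r partner
    pairing y r~y =
      proj₁ (proj₁ (partner-of-lonely-child lonely)) , partner-involutive y≢r (proj₂ lonely)
      , partner-≢ y≢r (proj₂ lonely) , sym (partners-agree r y lonely)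
      where
      lonely = root-neighbour-lonely r~y
      y≢r = child-≢root (proj₁ lonely)

  root-non-isolated : ¬ ¬ NonIsolated G r
  root-non-isolated isolated = vertex-in-block r λ (_ , isB , r∈B) →
    let open ShapedBlock (shaped isB)
        i , fi≡r = f-onto r∈B
        j , adj = C5-neighbour i
    in isolated (f j , subst (_~ f j) fi≡r (E⊆adj B (f i) (f j) (trans (f-E i j) adj)))

  contradiction : ⊥
  contradiction = root-non-isolated (root-not-odd ∘ ψ-odd r)

proposition1p6 : (n : ℕ) (G : Graph n) → Connected (whole G) → (∀ (H : Subgraph G) → IsBlock H → IsoC5 H) → ¬ OddColorable 4 G × (∀ (v : Fin n) → ∃ λ (φ : Coloring n 4) → Proper G φ × (∀ u → u ≢ v → OddCond G φ u) × EvenCond G φ v)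
proposition1p6 n G connected blocks-C5 = not-odd-colourable , nearly-odd-colouring
  where
  levelling-from : ∀ v → Levels.Levelling G v
  levelling-from v = Levels.levelling G v λ x → proj₂ connected x v refl refl

  not-odd-colourable : ¬ OddColorable 4 G
  not-odd-colourable (ψ , proper , odd) =
    NoOddColouring.contradiction (levelling-from (proj₁ (proj₁ connected))) blocks-C5 ψ proper odd

  nearly-odd-colouring : ∀ v → ∃ λ (φ : Coloring n 4)
                       → Proper G φ × (∀ u → u ≢ v → OddCond G φ u) × EvenCond G φ v
  nearly-odd-colouring v = φ , φ-proper , (λ _ → φ-odd) , φ-even-root
    where open Colouring (levelling-from v) blocks-C5
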